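{- Let $(E_1,\theta)\Rightarrow(E_2,\theta\delta)$ be a single step of the inference system, where $\delta$ is the substitution introduced by that step. Then $\{\delta\gamma\mid\gamma\in\mathcal{U}(E_2)\}\subseteq\mathcal{U}(E_1)$.
   Context: Terms are simply-typed $\lambda$-terms in $\beta\eta$-long normal form. Types are sorts $a$ or $(\sigma_1,\dots,\sigma_n)\to a$, with $()\to a=a$. There are typed variables $\mathcal{V}$, infinitely many of each type, and typed function symbols $\mathcal{F}$. Terms are generated as follows. If $h\in\mathcal{F}\cup\mathcal{V}$ has type $(\sigma_1,\dots,\sigma_n)\to a$ and $t_i:\sigma_i$, then $h(t_1,\dots,t_n):a$. If $t:a$ and $x_i:\sigma_i$, then $x_1,\dots,x_n.t:(\sigma_1,\dots,\sigma_n)\to a$. Terms are taken modulo $\alpha$-renaming, and bound variables are distinct and never free. The head of $\vec x.h(\vec t)$ is $h$, and $\mathrm{fv}$ denotes free variables. $x{\downarrow}=y_1,\dots,y_n.x(y_1{\downarrow},\dots,y_n{\downarrow})$ is the $\eta$-expansion of $x:(\sigma_1,\dots,\sigma_n)\to a$. Subterms: $\vec x.h(s_1,\dots,s_m)\trianglerighteq t$ iff the two are equal or $\vec x.s_i\trianglerighteq t$ for some $i$, with binder prefixes concatenated. Substitutions are finite type-preserving maps from variables to terms. Application is hereditary and capture-avoiding: - $x(\vec t)\theta=u\{\vec y\mapsto\vec t\theta\}$ if $\theta(x)=\vec y.u$; - $h(\vec t)\theta=h(\vec t\theta)$ if $h\notin\mathrm{dom}(\theta)$; - $(\vec x.t)\theta=\vec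 y.(t\{\vec x\mapsto\vec y\}\theta)$ for fresh $\vec y$. Composition: $\theta\delta=\{x\mapsto\theta(x)\delta\mid x\in\mathrm{dom}(\theta)\}\cup\{y\mapsto\delta(y)\mid y\in\mathrm{dom}(\delta)\setminus\mathrm{dom}(\theta)\}$. $\mathcal{U}(E)$ is the set of $\theta$ with $s\theta=t\theta$ for all $s\approx t\in E$. Expanded terms: $\vec x.s$ is expanded if it equals $\vec x,y_1,\dots,y_k.h(s_1,\dots,s_m,y_1{\downarrow},\dots,y_k{\downarrow})$ with $(\bigcup_i\mathrm{fv}(s_i)\cup\{h\})\cap\{\vec y\}=\varnothing$. For $\vec x=x_1,\dots,x_n$ and expanded $\vec x.t=\vec x,\vec y_k.h(t_1,\dots,t_m,\vec y{\downarrow})$, we write $\vec x.s\trianglerighteq_E\vec x.t$ iff there are $n'\ge n$ and terms $x_1,\dots,x_{n'}.t_{m+j}$ ($1\le j\le k$) with $\vec x.s\trianglerighteq x_1,\dots,x_{n'}.h(t_1,\dots,t_{m+k})$. DHPs: a term $s$ is a DHP if every subterm $\vec x.y(t_1,\dots,t_m)$ of $s$ with $y\notin\{\vec x\}$ satisfies, for all $i$: - (i) $\varnothing\ne\mathrm{fv}(t_i)\subseteq\{\vec x\}$; - (ii) $\vec x.t_i$ is expanded; - (iii) $\vec x.t_i\not\trianglerighteq_E\vec x.t_j$ for $j\ne i$. Partial bindings: a partial binding of type $\tau=(\sigma_1,\dots,\sigma_n)\to a$ is a DHP $x_1,\dots,x_n.h(\vec y^1.H_1(\vec x{\downarrow},\vec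 y^1{\downarrow}),\dots,\vec y^m.H_m(\vec x{\downarrow},\vec y^m{\downarrow}))$. Here $x_i:\sigma_i$, $h\in\mathcal{F}\cup\{\vec x\}$ has type $(\tau_1,\dots,\tau_m)\to a$ with $\tau_i=(\varphi^i_1,\dots,\varphi^i_{k_i})\to b_i$, $y^i_j:\varphi^i_j$, and the $H_i$ are fresh with $H_i:(\sigma_1,\dots,\sigma_n,\varphi^i_1,\dots,\varphi^i_{k_i})\to b_i$. It is a projection binding if $h\in\{\vec x\}$ and an imitation binding if $h\in\mathcal{F}$. Inference system on unification pairs $(E,\theta)$, where $E$ is a finite set of unordered pairs of same-typed DHPs: $E\sigma$ applies $\sigma$ to all terms. In every rule, $\vec x=x_1,\dots,x_k$ and $F,G$ are free variables not in $\vec x$. The rules are listed below, each with the substitution $\delta$ it introduces: - (Remove) $(\{s\approx s\}\uplus E,\theta)\Rightarrow(E,\theta)$, with $\delta=\varnothing$. - (Decompose) $(\{\vec x.h(\vec s_n)\approx\vec x.h(\vec t_n)\}\uplus E,\theta)\Rightarrow(\{\vec x.s_i\approx\vec x.t_i\}_{i\le n}\cup E,\theta)$, provided $h\in\mathcal{F}\cup\{\vec x\}$, with $\delta=\varnothing$. - (Eliminate) $(\{\vec x.F(x_1{\downarrow},\dots,x_k{\downarrow})\approx u\}\uplus E,\theta)\Rightarrow(E\delta,\theta\delta)$ with $\delta=\{F\mapsto u\}$, provided $F\notin\mathrm{fv}(u)$. - (Imitate) If $E\ni\vec x.F(\vec s)\approx\vec x.h(\vec t)$ with $h\in\mathcal{F}$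 and $F:\tau$, then $(E,\theta)\Rightarrow(E\delta,\theta\delta)$ with $\delta=\{F\mapsto u\}$, $u$ the imitation binding of type $\tau$ with head $h$. - (Project) Same shape as Imitate, but with $u$ a projection binding of type $\tau$ such that $(\vec x.F(\vec s))\{F\mapsto u\}$ has head $h\in\mathcal{F}\cup\{\vec x\}$. - (Same) $(\{\vec x.F(\vec s_n)\approx\vec x.F(\vec t_n)\}\uplus E,\theta)\Rightarrow(E\delta,\theta\delta)$ with $\delta=\{F\mapsto u\}$. Here $u=y_1,\dots,y_n.H(y_{i_1}{\downarrow},\dots,y_{i_m}{\downarrow})$, $H$ is fresh, and $\{i_1,\dots,i_m\}=\{i\mid\vec x.s_i=\vec x.t_i\}$. - (Different) $(\{\vec x.F(\vec s_n)\approx\vec x.G(\vec t_m)\}\uplus E,\theta)\Rightarrow(E\delta,\theta\delta)$ with $\delta=\{F\mapsto u,G\mapsto v\}$, provided $F\ne G$. Here $u=\vec y_n.H(u_1,\dots,u_l)$ and $v=\vec z_m.H(v_1,\dots,v_l)$ with $H$ fresh, and $\{(\vec y.u_i,\vec z.v_i)\}_{i\le l}=P_1\cup P_2$, where - $P_1=\{(\vec y.y_i{\downarrow},\vec z.w)\mid i\le n,\ \mathrm{fv}(w)\subseteq\{\vec z\},\ \vec x.s_i=\vec x.w\{\vec z\mapsto\vec t\}\}$; - $P_2=\{(\vec y.w,\vec z.z_i{\downarrow})\mid i\le m,\ \mathrm{fv}(w)\subseteq\{\vec y\},\ \vec x.w\{\vec y\mapsto\vec s\}=\vec x.t_i\}$.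 -}

module Defs where

-- Representation (locally nameless):
--  * bound variables are de Bruijn (typed membership proofs  τ ∈ Γ  into the
--    context of enclosing binders, outermost binder first);
--  * free variables are named: a variable is a name (ℕ) together with its
--    type, so there are infinitely many variables of each type;
--  * terms are intrinsically typed, so alpha-equivalence is syntactic equality.

open import Data.Nat using (ℕ)
open import Data.List using (List; []; _∷_; _++_)
open import Data.List.Membership.Propositional using (_∈_)
open import Data.List.Membership.Propositional.Properties
  using (∈-++⁺ˡ; ∈-++⁺ʳ; ∈-++⁻)
open import Data.List.Relation.Unary.Any using (here; there; index)
open import Data.List.Relation.Unary.All using (All; []; _∷_)
open import Data.List.Relation.Unary.Unique.Propositional using (Unique)
open import Data.List.Relation.Binary.Permutation.Propositional using (_↭_)
open import Data.List.Relation.Binary.Pointwise using (Pointwise)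
open import Data.Maybe using (Maybe; just; nothing)
open import Data.Product using (Σ; ∃; ∃-syntax; _×_; _,_)
open import Data.Sum using (_⊎_; inj₁; inj₂; [_,_]′)
open import Relation.Binary.PropositionalEquality using (_≡_; _≢_; refl)
open import Relation.Nullary using (¬_)
open import Function.Bundles using (_⇔_)

-- Types: (σ₁,…,σₙ) → a ; a sort a is ([] ⇒ a).
data Ty (Sort : Set) : Set where
  _⇒_ : List (Ty Sort) → Sort → Ty Sort

module Theory (Sort : Set) (Fun : Set)
              (funArgs : Fun → List (Ty Sort)) (funRes : Fun → Sort) where

  Type : Set
  Type = Ty Sort

  Ctx : Set
  Ctx = List Type

  record Var : Set where
    constructor mkVar
    field
      name  : ℕ
      vargs : Ctx
      vres  : Sort
  open Var public

  ty : Var → Type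
  ty x = vargs x ⇒ vres x

  data Head (Γ : Ctx) : Type → Set where
    bv : ∀ {τ} → τ ∈ Γ → Head Γ τ
    fv : (x : Var) → Head Γ (vargs x ⇒ vres x)
    fn : (f : Fun) → Head Γ (funArgs f ⇒ funRes f)

  data Tm (Γ : Ctx) : Type → Set
  data Atm (Γ : Ctx) (a : Sort) : Set
  data Args (Γ : Ctx) : Ctx → Set

  -- y₁,…,yₙ . t   (the new binders are appended to the context)
  data Tm Γ where
    lam : ∀ {σs a} → Atm (Γ ++ σs) a → Tm Γ (σs ⇒ a)

  data Atm Γ a where
    app : ∀ {σs} → Head Γ (σs ⇒ a) → Args Γ σs → Atm Γ a

  data Args Γ where
    []  : Args Γ []
    _∷_ : ∀ {σ σs} → Tm Γ σ → Args Γ σs → Args Γ (σ ∷ σs)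

  _++ᵃ_ : ∀ {Γ σs ρs} → Args Γ σs → Args Γ ρs → Args Γ (σs ++ ρs)
  [] ++ᵃ ts = ts
  (s ∷ ss) ++ᵃ ts = s ∷ (ss ++ᵃ ts)

  argAt : ∀ {Γ σs τ} → Args Γ σs → τ ∈ σs → Tm Γ τ
  argAt (t ∷ ts) (here refl) = t
  argAt (t ∷ ts) (there p)   = argAt ts p

  -- closed (top-level) terms; a top-level term of type (xs ⇒ a) is x⃗.h(…)
  -- x⃗.t  for t : Tm Γ τ  (binder prefixes concatenated)
  _⊕_ : Ctx → Type → Type
  Γ ⊕ (ys ⇒ b) = (Γ ++ ys) ⇒ b

  top : ∀ {Γ a} → Atm Γ a → Tm [] (Γ ⇒ a)
  top b = lam b

  bind : ∀ {Γ τ} → Tm Γ τ → Tm [] (Γ ⊕ τ)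
  bind (lam b) = lam b

  Ren : Ctx → Ctx → Set
  Ren Γ Δ = ∀ {τ} → τ ∈ Γ → τ ∈ Δ

  liftRen : ∀ {Γ Δ} ρs → Ren Γ Δ → Ren (Γ ++ ρs) (Δ ++ ρs)
  liftRen {Γ} {Δ} ρs r p = [ (λ q → ∈-++⁺ˡ (r q)) , ∈-++⁺ʳ Δ ]′ (∈-++⁻ Γ p)

  renH : ∀ {Γ Δ τ} → Ren Γ Δ → Head Γ τ → Head Δ τ
  renH r (bv i) = bv (r i)
  renH r (fv x) = fv x
  renH r (fn f) = fn f

  renT : ∀ {Γ Δ τ} → Ren Γ Δ → Tm Γ τ → Tm Δ τ
  renA : ∀ {Γ Δ a} → Ren Γ Δ → Atm Γ a → Atm Δ a
  renArgs : ∀ {Γ Δ σs} → Ren Γ Δ → Args Γ σs → Args Δ σs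
  renT r (lam {σs} b) = lam (renA (liftRen σs r) b)
  renA r (app h ts) = app (renH r h) (renArgs r ts)
  renArgs r [] = []
  renArgs r (t ∷ ts) = renT r t ∷ renArgs r ts

  wkH : ∀ {Γ τ} ρs → Head Γ τ → Head (Γ ++ ρs) τ
  wkH ρs = renH ∈-++⁺ˡ

  wkArgs : ∀ {Γ σs} ρs → Args Γ σs → Args (Γ ++ ρs) σs
  wkArgs ρs = renArgs ∈-++⁺ˡ

  etaT : ∀ {Γ} (τ : Type) → τ ∈ Γ → Tm Γ τ
  etaArgs : ∀ {Δ} (σs : Ctx) → (∀ {σ} → σ ∈ σs → σ ∈ Δ) → Args Δ σs
  etaT {Γ} (σs ⇒ a) i = lam (app (bv (∈-++⁺ˡ i)) (etaArgs σs (∈-++⁺ʳ Γ)))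
  etaArgs [] f = []
  etaArgs (σ ∷ σs) f = etaT σ (f (here refl)) ∷ etaArgs σs (λ p → f (there p))

  eta : ∀ {Γ τ} → τ ∈ Γ → Tm Γ τ
  eta {τ = τ} i = etaT τ i

  etaBlock : ∀ {Γ} ys → Args (Γ ++ ys) ys
  etaBlock {Γ} ys = etaArgs ys (∈-++⁺ʳ Γ)

  etaAll : ∀ Γ → Args Γ Γ
  etaAll Γ = etaArgs Γ (λ p → p)

  data _∈fvT_ (x : Var) {Γ} : ∀ {τ} → Tm Γ τ → Set
  data _∈fvA_ (x : Var) : ∀ {Γ a} → Atm Γ a → Set
  data _∈fvArgs_ (x : Var) {Γ} : ∀ {σs} → Args Γ σs → Set
  data _∈fvT_ x {Γ} where
    fv-lam : ∀ {σs a} {b : Atm (Γ ++ σs) a} → x ∈fvA b → x ∈fvT lam b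
  data _∈fvA_ x where
    fv-hd  : ∀ {Γ} {ts : Args Γ (vargs x)} → x ∈fvA app (fv x) ts
    fv-arg : ∀ {Γ a σs} {h : Head Γ (σs ⇒ a)} {ts : Args Γ σs} →
             x ∈fvArgs ts → x ∈fvA app h ts
  data _∈fvArgs_ x {Γ} where
    fv-here  : ∀ {σ σs} {t : Tm Γ σ} {ts : Args Γ σs} → x ∈fvT t → x ∈fvArgs (t ∷ ts)
    fv-there : ∀ {σ σs} {t : Tm Γ σ} {ts : Args Γ σs} → x ∈fvArgs ts → x ∈fvArgs (t ∷ ts)

  NoFV : ∀ {Γ τ} → Tm Γ τ → Set
  NoFV t = ∀ x → ¬ (x ∈fvT t)

  data OccT : ∀ {Γ τ σ} → τ ∈ Γ → Tm Γ σ → Set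
  data OccA : ∀ {Γ τ a} → τ ∈ Γ → Atm Γ a → Set
  data OccArgs : ∀ {Γ τ σs} → τ ∈ Γ → Args Γ σs → Set
  data OccT where
    occ-lam : ∀ {Γ τ σs a} {i : τ ∈ Γ} {b : Atm (Γ ++ σs) a} →
              OccA (∈-++⁺ˡ i) b → OccT i (lam b)
  data OccA where
    occ-hd  : ∀ {Γ σs a} {i : (σs ⇒ a) ∈ Γ} {ts : Args Γ σs} → OccA i (app (bv i) ts)
    occ-arg : ∀ {Γ τ σs a} {i : τ ∈ Γ} {h : Head Γ (σs ⇒ a)} {ts : Args Γ σs} →
              OccArgs i ts → OccA i (app h ts)
  data OccArgs where
    occ-here  : ∀ {Γ τ σ σs} {i : τ ∈ Γ} {t : Tm Γ σ} {ts : Args Γ σs} →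
                OccT i t → OccArgs i (t ∷ ts)
    occ-there : ∀ {Γ τ σ σs} {i : τ ∈ Γ} {t : Tm Γ σ} {ts : Args Γ σs} →
                OccArgs i ts → OccArgs i (t ∷ ts)

  -- Subterms (of top-level terms, binder prefixes concatenated)

  data _⊵_ : ∀ {τ τ'} → Tm [] τ → Tm [] τ' → Set where
    ⊵-refl : ∀ {τ} {t : Tm [] τ} → t ⊵ t
    ⊵-arg  : ∀ {Δ a σs σ τ'} {h : Head Δ (σs ⇒ a)} {ss : Args Δ σs}
               {t : Tm [] τ'} (i : σ ∈ σs) →
             bind (argAt ss i) ⊵ t → lam {σs = Δ} (app h ss) ⊵ t

  -- x⃗.t (t : Tm Xs τ) is expanded: t = y⃗.h(s₁,…,sₘ,y₁↓,…,yₖ↓) with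
  -- h and the sᵢ not mentioning y⃗ (i.e. weakenings of Xs-terms)
  data Expanded {Xs : Ctx} : ∀ {τ} → Tm Xs τ → Set where
    expanded : ∀ {ms ys a} (h : Head Xs ((ms ++ ys) ⇒ a)) (ss : Args Xs ms) →
               Expanded (lam {σs = ys} (app (wkH ys h) (wkArgs ys ss ++ᵃ etaBlock ys)))

  -- x⃗.s ⊵_E x⃗.t, for expanded x⃗.t = x⃗,y⃗.h(t₁,…,tₘ,y⃗↓): some subterm of x⃗.s
  -- has the form x₁,…,x_{n'}.h(t₁,…,tₘ,t_{m+1},…,t_{m+k})
  data _⊵E_ {Xs : Ctx} {σ : Type} (s : Tm Xs σ) : ∀ {τ} → Tm Xs τ → Set where
    ⊵E-intro : ∀ {ms ys a} (h : Head Xs ((ms ++ ys) ⇒ a)) (ss : Args Xs ms)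
           (Δ : Ctx) (rest : Args (Xs ++ Δ) ys) →
         bind s ⊵ lam {σs = Xs ++ Δ} (app (wkH Δ h) (wkArgs Δ ss ++ᵃ rest)) →
         s ⊵E lam {σs = ys} (app (wkH ys h) (wkArgs ys ss ++ᵃ etaBlock ys))

  record DHPArgs {Xs σs : Ctx} (ts : Args Xs σs) : Set where
    field
      cond-i   : ∀ {σ} (i : σ ∈ σs) →
                 (∃[ τ ] Σ (τ ∈ Xs) λ j → OccT j (argAt ts i)) × NoFV (argAt ts i)
      cond-ii  : ∀ {σ} (i : σ ∈ σs) → Expanded (argAt ts i)
      cond-iii : ∀ {σ σ'} (i : σ ∈ σs) (j : σ' ∈ σs) → index i ≢ index j →
                 ¬ (argAt ts i ⊵E argAt ts j)

  DHP : ∀ {τ} → Tm [] τ → Set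
  DHP s = ∀ {Xs n σs a} (ts : Args Xs σs) →
          s ⊵ lam {σs = Xs} (app (fv (mkVar n σs a)) ts) → DHPArgs ts

  data Entry (Γ : Ctx) (τ : Type) : Set where
    ren : τ ∈ Γ → Entry Γ τ
    tm  : Tm Γ τ → Entry Γ τ

  Env : Ctx → Ctx → Set
  Env Δ Γ = ∀ {τ} → τ ∈ Δ → Entry Γ τ

  wkEntry : ∀ {Γ τ} ρs → Entry Γ τ → Entry (Γ ++ ρs) τ
  wkEntry ρs (ren j) = ren (∈-++⁺ˡ j)
  wkEntry ρs (tm t)  = tm (renT ∈-++⁺ˡ t)

  liftEnv : ∀ {Δ Γ} ρs → Env Δ Γ → Env (Δ ++ ρs) (Γ ++ ρs)
  liftEnv {Δ} {Γ} ρs env p =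
    [ (λ q → wkEntry ρs (env q)) , (λ q → ren (∈-++⁺ʳ Γ q)) ]′ (∈-++⁻ Δ p)

  argsEnv : ∀ {Γ σs} → Args Γ σs → Env σs Γ
  argsEnv ts i = tm (argAt ts i)

  extEnv : ∀ {Γ zs} → Args Γ zs → Env (Γ ++ zs) Γ
  extEnv {Γ} ts p = [ ren , (λ q → tm (argAt ts q)) ]′ (∈-++⁻ Γ p)

  data InstT : ∀ {Δ Γ τ} → Env Δ Γ → Tm Δ τ → Tm Γ τ → Set
  data InstA : ∀ {Δ Γ a} → Env Δ Γ → Atm Δ a → Atm Γ a → Set
  data InstArgs : ∀ {Δ Γ σs} → Env Δ Γ → Args Δ σs → Args Γ σs → Set
  data InstT where
    i-lam : ∀ {Δ Γ σs a} {env : Env Δ Γ} {b : Atm (Δ ++ σs) a} {b'} →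
            InstA (liftEnv σs env) b b' → InstT env (lam b) (lam b')
  data InstA where
    i-ren : ∀ {Δ Γ σs a} {env : Env Δ Γ} {i : (σs ⇒ a) ∈ Δ} {j}
              {ts : Args Δ σs} {ts'} →
            env i ≡ ren j → InstArgs env ts ts' →
            InstA env (app (bv i) ts) (app (bv j) ts')
    i-tm  : ∀ {Δ Γ σs a} {env : Env Δ Γ} {i : (σs ⇒ a) ∈ Δ}
              {w : Atm (Γ ++ σs) a} {ts : Args Δ σs} {ts'} {r} →
            env i ≡ tm (lam w) → InstArgs env ts ts' →
            InstA (extEnv ts') w r →
            InstA env (app (bv i) ts) r
    i-fv  : ∀ {Δ Γ} {env : Env Δ Γ} {x : Var} {ts : Args Δ (vargs x)} {ts'} →
            InstArgs env ts ts' → InstA env (app (fv x) ts) (app (fv x) ts')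
    i-fn  : ∀ {Δ Γ} {env : Env Δ Γ} {f : Fun} {ts : Args Δ (funArgs f)} {ts'} →
            InstArgs env ts ts' → InstA env (app (fn f) ts) (app (fn f) ts')
  data InstArgs where
    i-[] : ∀ {Δ Γ} {env : Env Δ Γ} → InstArgs env [] []
    i-∷  : ∀ {Δ Γ σ σs} {env : Env Δ Γ} {t : Tm Δ σ} {t'} {ts : Args Δ σs} {ts'} →
           InstT env t t' → InstArgs env ts ts' → InstArgs env (t ∷ ts) (t' ∷ ts')

  record Subst : Set where
    field
      at     : (x : Var) → Maybe (Tm [] (ty x))
      dom    : List Var
      finite : ∀ x {t} → at x ≡ just t → x ∈ dom
  open Subst public

  data AppT (θ : Subst) : ∀ {Γ τ} → Tm Γ τ → Tm Γ τ → Set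
  data AppA (θ : Subst) : ∀ {Γ a} → Atm Γ a → Atm Γ a → Set
  data AppArgs (θ : Subst) : ∀ {Γ σs} → Args Γ σs → Args Γ σs → Set
  data AppT θ where
    a-lam : ∀ {Γ σs a} {b b' : Atm (Γ ++ σs) a} →
            AppA θ b b' → AppT θ (lam {σs = σs} b) (lam {σs = σs} b')
  data AppA θ where
    a-bv  : ∀ {Γ σs a} {i : (σs ⇒ a) ∈ Γ} {ts : Args Γ σs} {ts'} →
            AppArgs θ ts ts' → AppA θ (app (bv i) ts) (app (bv i) ts')
    a-fn  : ∀ {Γ} {f : Fun} {ts : Args Γ (funArgs f)} {ts'} →
            AppArgs θ ts ts' → AppA θ (app (fn f) ts) (app (fn f) ts')
    a-fv₀ : ∀ {Γ} {x : Var} {ts : Args Γ (vargs x)} {ts'} →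
            at θ x ≡ nothing → AppArgs θ ts ts' →
            AppA θ (app (fv x) ts) (app (fv x) ts')
    a-fv₁ : ∀ {Γ} {x : Var} {u : Atm (vargs x) (vres x)} {ts : Args Γ (vargs x)} {ts'} {r} →
            at θ x ≡ just (lam u) → AppArgs θ ts ts' →
            InstA (argsEnv ts') u r →
            AppA θ (app (fv x) ts) r
  data AppArgs θ where
    a-[] : ∀ {Γ} → AppArgs θ {Γ} [] []
    a-∷  : ∀ {Γ σ σs} {t : Tm Γ σ} {t'} {ts : Args Γ σs} {ts'} →
           AppT θ t t' → AppArgs θ ts ts' → AppArgs θ (t ∷ ts) (t' ∷ ts')

  record IsComp (θ δ η : Subst) : Set where
    field
      comp-in  : ∀ x {t} → at θ x ≡ just t →
                 ∃[ t' ] (AppT δ t t' × at η x ≡ just t')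
      comp-out : ∀ x → at θ x ≡ nothing → at η x ≡ at δ x

  IsEmpty : Subst → Set
  IsEmpty δ = ∀ x → at δ x ≡ nothing

  Maps1 : Subst → (F : Var) → Tm [] (ty F) → Set
  Maps1 δ F u = at δ F ≡ just u × (∀ x → x ≢ F → at δ x ≡ nothing)

  Maps2 : Subst → (F : Var) → Tm [] (ty F) → (G : Var) → Tm [] (ty G) → Set
  Maps2 δ F u G v = at δ F ≡ just u × at δ G ≡ just v ×
                    (∀ x → x ≢ F → x ≢ G → at δ x ≡ nothing)

  -- Unification problems: finite sets (lists) of unordered pairs

  Pair : Set
  Pair = Σ Type λ τ → Tm [] τ × Tm [] τ

  _≈_ : ∀ {τ} → Tm [] τ → Tm [] τ → Pair
  s ≈ t = (_ , s , t)

  _∈E_ : Pair → List Pair → Set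
  (τ , s , t) ∈E E = (τ , s , t) ∈ E ⊎ (τ , t , s) ∈ E

  Picks : List Pair → ∀ {τ} → Tm [] τ → Tm [] τ → List Pair → Set
  Picks E₁ s t E = E₁ ↭ (s ≈ t) ∷ E ⊎ E₁ ↭ (t ≈ s) ∷ E

  data AppPair (θ : Subst) : Pair → Pair → Set where
    app-pair : ∀ {τ} {s t s' t' : Tm [] τ} →
               AppT θ s s' → AppT θ t t' → AppPair θ (s ≈ t) (s' ≈ t')

  AppE : Subst → List Pair → List Pair → Set
  AppE θ E E' = Pointwise (AppPair θ) E E'

  _∈𝒰_ : Subst → List Pair → Set
  θ ∈𝒰 E = ∀ {τ} {s t : Tm [] τ} → (s ≈ t) ∈ E →
           ∃[ u ] (AppT θ s u × AppT θ t u)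

  zipBind : ∀ {xs σs} → Args xs σs → Args xs σs → List Pair
  zipBind [] [] = []
  zipBind (s ∷ ss) (t ∷ ts) = (bind s ≈ bind t) ∷ zipBind ss ts

  DHPProblem : List Pair → Set
  DHPProblem E = ∀ {τ} {s t : Tm [] τ} → (s ≈ t) ∈ E → DHP s × DHP t

  Fresh : Var → List Pair → Subst → Set
  Fresh H E θ = (∀ {τ} {s t : Tm [] τ} → (s ≈ t) ∈ E → ¬ (H ∈fvT s) × ¬ (H ∈fvT t))
              × at θ H ≡ nothing
              × (∀ x {t} → at θ x ≡ just t → ¬ (H ∈fvT t))

  pbVars : (σs : Ctx) (τs : Ctx) → All (λ _ → ℕ) τs → List Var
  pbVars σs [] [] = []
  pbVars σs ((ys ⇒ b) ∷ τs) (n ∷ ns) = mkVar n (σs ++ ys) b ∷ pbVars σs τs ns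

  pbArgs : (σs : Ctx) (τs : Ctx) → All (λ _ → ℕ) τs → Args σs τs
  pbArgs σs [] [] = []
  pbArgs σs ((ys ⇒ b) ∷ τs) (n ∷ ns) =
    lam (app (fv (mkVar n (σs ++ ys) b)) (etaAll (σs ++ ys))) ∷ pbArgs σs τs ns

  pb : ∀ {a} (σs : Ctx) {τs} → Head σs (τs ⇒ a) → All (λ _ → ℕ) τs → Tm [] (σs ⇒ a)
  pb σs {τs} h ns = lam (app h (pbArgs σs τs ns))

  FreshAll : List Var → List Pair → Subst → Set
  FreshAll Hs E θ = Unique Hs × (∀ {H} → H ∈ Hs → Fresh H E θ)

  data SameHead {Γ} : ∀ {τ τ'} → Head Γ τ → Head Γ τ' → Set where
    same-bv : ∀ {τ τ'} {i : τ ∈ Γ} {j : τ' ∈ Γ} → index i ≡ index j →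
              SameHead (bv i) (bv j)
    same-fv : ∀ {x} → SameHead (fv x) (fv x)
    same-fn : ∀ {f} → SameHead (fn f) (fn f)

  data HeadIs {Γ a} : ∀ {τ} → Atm Γ a → Head Γ τ → Set where
    head-is : ∀ {σs τ} {h : Head Γ (σs ⇒ a)} {ts : Args Γ σs} {h' : Head Γ τ} →
              SameHead h h' → HeadIs (app h ts) h'

  data Rigid {Γ} : ∀ {τ} → Head Γ τ → Set where
    rigid-bv : ∀ {τ} {i : τ ∈ Γ} → Rigid (bv i)
    rigid-fn : ∀ {f} → Rigid (fn f)

  -- (Same): selection of the positions i with sᵢ = tᵢ (in order)

  data Sel : Ctx → Ctx → Set where
    done : Sel [] []
    keep : ∀ {σ σs ρs} → Sel σs ρs → Sel (σ ∷ σs) (σ ∷ ρs)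
    skip : ∀ {σ σs ρs} → Sel σs ρs → Sel (σ ∷ σs) ρs

  selVar : ∀ {σs ρs τ} → Sel σs ρs → τ ∈ ρs → τ ∈ σs
  selVar (keep s) (here refl) = here refl
  selVar (keep s) (there p)   = there (selVar s p)
  selVar (skip s) p           = there (selVar s p)

  data SelEq {Γ} : ∀ {σs ρs} → Sel σs ρs → Args Γ σs → Args Γ σs → Set where
    se-done : SelEq done [] []
    se-keep : ∀ {σ σs ρs} {sel : Sel σs ρs} {s : Tm Γ σ} {ss ts} →
              SelEq sel ss ts → SelEq (keep sel) (s ∷ ss) (s ∷ ts)
    se-skip : ∀ {σ σs ρs} {sel : Sel σs ρs} {s t : Tm Γ σ} {ss ts} →
              s ≢ t → SelEq sel ss ts → SelEq (skip sel) (s ∷ ss) (t ∷ ts)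

  ArgPair : Ctx → Ctx → Set
  ArgPair σs ρs = Σ Type λ κ → Tm σs κ × Tm ρs κ

  zipArgs : ∀ {σs ρs κs} → Args σs κs → Args ρs κs → List (ArgPair σs ρs)
  zipArgs [] [] = []
  zipArgs (u ∷ us) (v ∷ vs) = (_ , u , v) ∷ zipArgs us vs

  P₁ : ∀ {xs σs ρs} → Args xs σs → Args xs ρs → ArgPair σs ρs → Set
  P₁ {σs = σs} ss ts (κ , u , w) =
    Σ (κ ∈ σs) λ i → u ≡ eta i × NoFV w × InstT (argsEnv ts) w (argAt ss i)

  P₂ : ∀ {xs σs ρs} → Args xs σs → Args xs ρs → ArgPair σs ρs → Set
  P₂ {ρs = ρs} ss ts (κ , w , v) =
    Σ (κ ∈ ρs) λ i → v ≡ eta i × NoFV w × InstT (argsEnv ss) w (argAt ts i)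

  DiffSpec : ∀ {xs σs ρs κs} → Args xs σs → Args xs ρs →
             Args σs κs → Args ρs κs → Set
  DiffSpec ss ts us vs =
    Unique (zipArgs us vs) ×
    (∀ e → (e ∈ zipArgs us vs) ⇔ (P₁ ss ts e ⊎ P₂ ss ts e))

  -- The inference system:  Step E₁ θ E₂ θ' δ  means
  --   (E₁, θ) ⇒ (E₂, θ')  with introduced substitution δ, and θ' = θδ.

  data Step (E₁ : List Pair) (θ : Subst) : List Pair → Subst → Subst → Set where

    remove : ∀ {τ} {s : Tm [] τ} {E θ' δ} →
      Picks E₁ s s E → IsEmpty δ → IsComp θ δ θ' →
      Step E₁ θ E θ' δ

    decompose : ∀ {xs σs a} {h : Head xs (σs ⇒ a)} {ss ts : Args xs σs} {E θ' δ} →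
      Rigid h →
      Picks E₁ (top (app h ss)) (top (app h ts)) E →
      IsEmpty δ → IsComp θ δ θ' →
      Step E₁ θ (zipBind ss ts ++ E) θ' δ

    eliminate : ∀ {n xs a} {u : Tm [] (xs ⇒ a)} {E E₂ θ' δ} →
      Picks E₁ (top (app (fv (mkVar n xs a)) (etaAll xs))) u E →
      ¬ (mkVar n xs a ∈fvT u) →
      Maps1 δ (mkVar n xs a) u → AppE δ E E₂ → IsComp θ δ θ' →
      Step E₁ θ E₂ θ' δ

    imitate : ∀ {n xs σs} {f : Fun} {ss : Args xs σs} {ts : Args xs (funArgs f)}
                (names : All (λ _ → ℕ) (funArgs f)) {E₂ θ' δ} →
      (top (app (fv (mkVar n σs (funRes f))) ss) ≈ lam (app (fn f) ts)) ∈E E₁ →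
      DHP (pb σs (fn f) names) →
      FreshAll (pbVars σs (funArgs f) names) E₁ θ →
      Maps1 δ (mkVar n σs (funRes f)) (pb σs (fn f) names) →
      AppE δ E₁ E₂ → IsComp θ δ θ' →
      Step E₁ θ E₂ θ' δ

    project : ∀ {n xs σs a τs τs'} {ss : Args xs σs}
                {h : Head xs (τs ⇒ a)} {ts : Args xs τs}
                (k : (τs' ⇒ a) ∈ σs) (names : All (λ _ → ℕ) τs')
                {r : Atm xs a} {E₂ θ' δ} →
      Rigid h →
      (top (app (fv (mkVar n σs a)) ss) ≈ lam (app h ts)) ∈E E₁ →
      DHP (pb σs (bv k) names) →
      FreshAll (pbVars σs τs' names) E₁ θ →
      Maps1 δ (mkVar n σs a) (pb σs (bv k) names) →
      AppT δ (top (app (fv (mkVar n σs a)) ss)) (top r) → HeadIs r h →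
      AppE δ E₁ E₂ → IsComp θ δ θ' →
      Step E₁ θ E₂ θ' δ

    same : ∀ {n m xs σs ρs a} {ss ts : Args xs σs} (sel : Sel σs ρs) {E E₂ θ' δ} →
      Picks E₁ (top (app (fv (mkVar n σs a)) ss)) (top (app (fv (mkVar n σs a)) ts)) E →
      SelEq sel ss ts →
      Fresh (mkVar m ρs a) E₁ θ →
      Maps1 δ (mkVar n σs a)
              (top (app (fv (mkVar m ρs a)) (etaArgs ρs (selVar sel)))) →
      AppE δ E E₂ → IsComp θ δ θ' →
      Step E₁ θ E₂ θ' δ

    different : ∀ {nF nG nH xs σs ρs κs a} {ss : Args xs σs} {ts : Args xs ρs}
                  (us : Args σs κs) (vs : Args ρs κs) {E E₂ θ' δ} →
      mkVar nF σs a ≢ mkVar nG ρs a →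
      Picks E₁ (top (app (fv (mkVar nF σs a)) ss)) (top (app (fv (mkVar nG ρs a)) ts)) E →
      Fresh (mkVar nH κs a) E₁ θ →
      DiffSpec ss ts us vs →
      Maps2 δ (mkVar nF σs a) (top (app (fv (mkVar nH κs a)) us))
              (mkVar nG ρs a) (top (app (fv (mkVar nH κs a)) vs)) →
      AppE δ E E₂ → IsComp θ δ θ' →
      Step E₁ θ E₂ θ' δ

module Submission where

-- Every rule other than Imitate and Project removes one pair s ≈ t and applies
-- its δ to the rest, and δ already unifies s and t: trivially for Remove and
-- Decompose; for Eliminate because instantiating x⃗ by x⃗↓ is the identity; for
-- Same because H keeps exactly the positions where the two argument lists
-- agree; for Different because every argument of H is a pair from P₁ ∪ P₂ whose
-- two sides instantiate to the same term, while δ fixes the arguments of the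
-- flex heads, which are closed by DHP condition (i).  Then δγ unifies s ≈ t as
-- well, and it unifies the other pairs because t(δγ) = (tδ)γ.
--
-- That last identity carries the weight.  It reduces to the substitution lemma
-- for hereditary instantiation, u{φ}{ψ} = u{φ followed by ψ}, proved by
-- induction on the sizes of the types of the instantiated variables: at a
-- redex y(t⃗) with φ(y) = z⃗.w both ways round end in instantiating w, whose
-- bound variables z⃗ have smaller types than y.

open import Defs
open import Data.Empty using (⊥-elim)
open import Data.List using (List; []; _∷_; _++_)
open import Data.List.Membership.Propositional using (_∈_)
open import Data.List.Membership.Propositional.Properties using (∈-++⁺ˡ; ∈-++⁺ʳ; ∈-++⁻)
open import Data.List.Relation.Unary.Any using (here; there)
open import Data.List.Relation.Unary.Any.Properties using (++⁺∘++⁻; ++⁻∘++⁺)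
open import Data.List.Relation.Binary.Permutation.Propositional using (↭-sym)
open import Data.List.Relation.Binary.Permutation.Propositional.Properties using (∈-resp-↭)
open import Data.List.Relation.Binary.Pointwise using ([]; _∷_)
open import Data.Maybe using (just; nothing)
open import Data.Nat using (ℕ; zero; suc; _+_; _≤_; _<_; s≤s)
open import Data.Nat.Properties
  using (m≤m+n; m≤n+m; ≤-refl; ≤-trans; <-≤-trans; <⇒≤; ≤-pred; +-monoˡ-≤; +-comm)
open import Data.Product using (Σ; ∃-syntax; _×_; _,_; proj₂)
open import Data.Sum using (_⊎_; inj₁; inj₂; [_,_]′)
open import Function.Bundles using (Equivalence)
open import Relation.Nullary using (¬_)
open import Relation.Binary.PropositionalEquality
  using (_≡_; refl; sym; trans; cong; cong₂; subst)

module Soundness (Sort Fun : Set) (funArgs : Fun → List (Ty Sort)) (funRes : Fun → Sort) where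
  open Theory Sort Fun funArgs funRes

  private variable
    Γ Γ' Δ Δ' Θ σs ρs zs : Ctx
    σ τ : Type
    a : Sort
    n : ℕ

  data Split (Γ ρs : Ctx) : τ ∈ Γ ++ ρs → Set where
    left  : (q : τ ∈ Γ)  → Split Γ ρs (∈-++⁺ˡ q)
    right : (q : τ ∈ ρs) → Split Γ ρs (∈-++⁺ʳ Γ q)

  split : ∀ Γ (p : τ ∈ Γ ++ ρs) → Split Γ ρs p
  split Γ p with ∈-++⁻ Γ p | ++⁺∘++⁻ Γ p
  ... | inj₁ q | refl = left q
  ... | inj₂ q | refl = right q

  ++⁻-ˡ : ∀ Γ {ρs} (q : τ ∈ Γ) → ∈-++⁻ Γ {ρs} (∈-++⁺ˡ q) ≡ inj₁ q
  ++⁻-ˡ Γ q = ++⁻∘++⁺ Γ (inj₁ q)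

  ++⁻-ʳ : ∀ Γ {ρs} (q : τ ∈ ρs) → ∈-++⁻ Γ (∈-++⁺ʳ Γ q) ≡ inj₂ q
  ++⁻-ʳ Γ q = ++⁻∘++⁺ Γ (inj₂ q)

  size : Type → ℕ
  sizes : Ctx → ℕ
  size (σs ⇒ a) = suc (sizes σs)
  sizes [] = 0
  sizes (σ ∷ σs) = size σ + sizes σs

  ∈⇒size≤sizes : σ ∈ σs → size σ ≤ sizes σs
  ∈⇒size≤sizes (here refl) = m≤m+n _ _
  ∈⇒size≤sizes {σs = τ ∷ _} (there p) = ≤-trans (∈⇒size≤sizes p) (m≤n+m _ (size τ))

  _≗ʳ_ : Ren Γ Δ → Ren Γ Δ → Set
  _≗ʳ_ {Γ} r r' = ∀ {τ} (p : τ ∈ Γ) → r p ≡ r' p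

  liftRen-∘ : ∀ ρs {r₁ : Ren Γ Δ} {r₂ : Ren Δ Θ} {r : Ren Γ Θ} → (λ p → r₂ (r₁ p)) ≗ʳ r →
              (λ p → liftRen ρs r₂ (liftRen ρs r₁ p)) ≗ʳ liftRen ρs r
  liftRen-∘ {Γ} {Δ} ρs {r₁} e p with split Γ p
  ... | left q  rewrite ++⁻-ˡ Γ {ρs} q | ++⁻-ˡ Δ {ρs} (r₁ q) = cong ∈-++⁺ˡ (e q)
  ... | right q rewrite ++⁻-ʳ Γ q | ++⁻-ʳ Δ q = refl

  liftRen-id : ∀ ρs {r : Ren Γ Γ} → r ≗ʳ (λ p → p) → liftRen ρs r ≗ʳ (λ p → p)
  liftRen-id {Γ} ρs e p with split Γ p
  ... | left q  rewrite ++⁻-ˡ Γ {ρs} q = cong ∈-++⁺ˡ (e q)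
  ... | right q rewrite ++⁻-ʳ Γ q = refl

  renH-∘ : {r₁ : Ren Γ Δ} {r₂ : Ren Δ Θ} {r : Ren Γ Θ} → (λ p → r₂ (r₁ p)) ≗ʳ r →
           (h : Head Γ τ) → renH r₂ (renH r₁ h) ≡ renH r h
  renH-∘ e (bv i) = cong bv (e i)
  renH-∘ e (fv x) = refl
  renH-∘ e (fn f) = refl

  renT-∘ : {r₁ : Ren Γ Δ} {r₂ : Ren Δ Θ} {r : Ren Γ Θ} → (λ p → r₂ (r₁ p)) ≗ʳ r →
           (t : Tm Γ τ) → renT r₂ (renT r₁ t) ≡ renT r t
  renA-∘ : {r₁ : Ren Γ Δ} {r₂ : Ren Δ Θ} {r : Ren Γ Θ} → (λ p → r₂ (r₁ p)) ≗ʳ r →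
           (t : Atm Γ a) → renA r₂ (renA r₁ t) ≡ renA r t
  renArgs-∘ : {r₁ : Ren Γ Δ} {r₂ : Ren Δ Θ} {r : Ren Γ Θ} → (λ p → r₂ (r₁ p)) ≗ʳ r →
              (ts : Args Γ σs) → renArgs r₂ (renArgs r₁ ts) ≡ renArgs r ts
  renT-∘ {r₁ = r₁} {r₂} {r} e (lam {σs} b) =
    cong lam (renA-∘ (liftRen-∘ σs {r₁} {r₂} {r} e) b)
  renA-∘ e (app h ts) = cong₂ app (renH-∘ e h) (renArgs-∘ e ts)
  renArgs-∘ e [] = refl
  renArgs-∘ e (t ∷ ts) = cong₂ _∷_ (renT-∘ e t) (renArgs-∘ e ts)

  renH-id : {r : Ren Γ Γ} → r ≗ʳ (λ p → p) → (h : Head Γ τ) → renH r h ≡ h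
  renH-id e (bv i) = cong bv (e i)
  renH-id e (fv x) = refl
  renH-id e (fn f) = refl

  renT-id : {r : Ren Γ Γ} → r ≗ʳ (λ p → p) → (t : Tm Γ τ) → renT r t ≡ t
  renA-id : {r : Ren Γ Γ} → r ≗ʳ (λ p → p) → (t : Atm Γ a) → renA r t ≡ t
  renArgs-id : {r : Ren Γ Γ} → r ≗ʳ (λ p → p) → (ts : Args Γ σs) → renArgs r ts ≡ ts
  renT-id {r = r} e (lam {σs} b) = cong lam (renA-id (liftRen-id σs {r} e) b)
  renA-id e (app h ts) = cong₂ app (renH-id e h) (renArgs-id e ts)
  renArgs-id e [] = refl
  renArgs-id e (t ∷ ts) = cong₂ _∷_ (renT-id e t) (renArgs-id e ts)

  argAt-renArgs : (r : Ren Γ Δ) (ts : Args Γ σs) (k : τ ∈ σs) →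
                  argAt (renArgs r ts) k ≡ renT r (argAt ts k)
  argAt-renArgs r (t ∷ ts) (here refl) = refl
  argAt-renArgs r (t ∷ ts) (there k) = argAt-renArgs r ts k

  _≗ᵉ_ : Env Δ Γ → Env Δ Γ → Set
  _≗ᵉ_ {Δ} σ σ' = ∀ {τ} (i : τ ∈ Δ) → σ i ≡ σ' i

  liftEnv-ˡ : ∀ ρs (σ : Env Δ Γ) (q : τ ∈ Δ) → liftEnv ρs σ (∈-++⁺ˡ q) ≡ wkEntry ρs (σ q)
  liftEnv-ˡ {Δ} ρs σ q rewrite ++⁻-ˡ Δ {ρs} q = refl

  liftEnv-ʳ : ∀ ρs (σ : Env Δ Γ) (q : τ ∈ ρs) →
              liftEnv ρs σ (∈-++⁺ʳ Δ q) ≡ ren (∈-++⁺ʳ Γ q)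
  liftEnv-ʳ {Δ} ρs σ q rewrite ++⁻-ʳ Δ {ρs} q = refl

  extEnv-ˡ : (ts : Args Γ zs) (q : τ ∈ Γ) → extEnv ts (∈-++⁺ˡ q) ≡ ren q
  extEnv-ˡ {Γ} {zs} ts q rewrite ++⁻-ˡ Γ {zs} q = refl

  extEnv-ʳ : (ts : Args Γ zs) (q : τ ∈ zs) → extEnv ts (∈-++⁺ʳ Γ q) ≡ tm (argAt ts q)
  extEnv-ʳ {Γ} {zs} ts q rewrite ++⁻-ʳ Γ {zs} q = refl

  -- The termination measure of hereditary instantiation.
  Bounded : ℕ → Env Δ Γ → Set
  Bounded {Δ} n σ = ∀ {τ} (i : τ ∈ Δ) {t} → σ i ≡ tm t → size τ < n

  bounded-≤ : ∀ {m} {σ : Env Δ Γ} → m ≤ n → Bounded m σ → Bounded n σ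
  bounded-≤ m≤n b i eq = <-≤-trans (b i eq) m≤n

  liftEnv-bounded : ∀ ρs {σ : Env Δ Γ} → Bounded n σ → Bounded n (liftEnv ρs σ)
  liftEnv-bounded {Δ} ρs {σ} b p eq with split Δ p
  ... | right q rewrite ++⁻-ʳ Δ {ρs} q with () ← eq
  ... | left q rewrite ++⁻-ˡ Δ {ρs} q with σ q in σq≡
  ...   | tm _ = b q σq≡
  ...   | ren _ with () ← eq

  argsEnv-bounded : (ts : Args Γ σs) → Bounded (suc (sizes σs)) (argsEnv ts)
  argsEnv-bounded ts i _ = s≤s (∈⇒size≤sizes i)

  extEnv-bounded : (ts : Args Γ zs) → Bounded (suc (sizes zs)) (extEnv ts)
  extEnv-bounded {Γ} {zs} ts p eq with split Γ p
  ... | left q rewrite ++⁻-ˡ Γ {zs} q with () ← eq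
  ... | right q = s≤s (∈⇒size≤sizes q)

  instT-total : (σ : Env Δ Γ) → Bounded n σ → (t : Tm Δ τ) → ∃[ t' ] InstT σ t t'
  instA-total : (σ : Env Δ Γ) → Bounded n σ → (t : Atm Δ a) → ∃[ t' ] InstA σ t t'
  instArgs-total : (σ : Env Δ Γ) → Bounded n σ → (ts : Args Δ σs) →
                   ∃[ ts' ] InstArgs σ ts ts'
  instT-total σ b (lam {σs} w) with instA-total (liftEnv σs σ) (liftEnv-bounded σs b) w
  ... | w' , d = lam w' , i-lam d
  instA-total σ b (app (bv i) ts) with σ i in σi≡ | instArgs-total σ b ts
  ... | ren j | ts' , d = app (bv j) ts' , i-ren σi≡ d
  instA-total {n = zero} σ b (app (bv i) ts) | tm (lam w) | _ with () ← b i σi≡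
  instA-total {n = suc n} σ b (app (bv i) ts) | tm (lam w) | ts' , d
    with instA-total (extEnv ts') (bounded-≤ (≤-pred (b i σi≡)) (extEnv-bounded ts')) w
  ... | r , d' = r , i-tm σi≡ d d'
  instA-total σ b (app (fv x) ts) with instArgs-total σ b ts
  ... | ts' , d = app (fv x) ts' , i-fv d
  instA-total σ b (app (fn f) ts) with instArgs-total σ b ts
  ... | ts' , d = app (fn f) ts' , i-fn d
  instArgs-total σ b [] = [] , i-[]
  instArgs-total σ b (t ∷ ts) with instT-total σ b t | instArgs-total σ b ts
  ... | t' , d | ts' , ds = t' ∷ ts' , i-∷ d ds

  instT-det : {σ : Env Δ Γ} {t : Tm Δ τ} {r₁ r₂ : Tm Γ τ} →
              InstT σ t r₁ → InstT σ t r₂ → r₁ ≡ r₂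
  instA-det : {σ : Env Δ Γ} {t : Atm Δ a} {r₁ r₂ : Atm Γ a} →
              InstA σ t r₁ → InstA σ t r₂ → r₁ ≡ r₂
  instArgs-det : {σ : Env Δ Γ} {ts : Args Δ σs} {rs₁ rs₂ : Args Γ σs} →
                 InstArgs σ ts rs₁ → InstArgs σ ts rs₂ → rs₁ ≡ rs₂
  instT-det (i-lam d₁) (i-lam d₂) = cong lam (instA-det d₁ d₂)
  instA-det (i-ren e₁ d₁) (i-ren e₂ d₂) with refl ← trans (sym e₁) e₂ =
    cong (app (bv _)) (instArgs-det d₁ d₂)
  instA-det (i-ren e₁ _) (i-tm e₂ _ _) with () ← trans (sym e₁) e₂
  instA-det (i-tm e₁ _ _) (i-ren e₂ _) with () ← trans (sym e₁) e₂
  instA-det (i-tm e₁ d₁ s₁) (i-tm e₂ d₂ s₂)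
    with refl ← trans (sym e₁) e₂ | refl ← instArgs-det d₁ d₂ = instA-det s₁ s₂
  instA-det (i-fv d₁) (i-fv d₂) = cong (app (fv _)) (instArgs-det d₁ d₂)
  instA-det (i-fn d₁) (i-fn d₂) = cong (app (fn _)) (instArgs-det d₁ d₂)
  instArgs-det i-[] i-[] = refl
  instArgs-det (i-∷ d₁ ds₁) (i-∷ d₂ ds₂) = cong₂ _∷_ (instT-det d₁ d₂) (instArgs-det ds₁ ds₂)

  instArgs-argAt : {σ : Env Δ Γ} {ts : Args Δ σs} {ts' : Args Γ σs} → InstArgs σ ts ts' →
                   (k : τ ∈ σs) → InstT σ (argAt ts k) (argAt ts' k)
  instArgs-argAt (i-∷ d ds) (here refl) = d
  instArgs-argAt (i-∷ d ds) (there k) = instArgs-argAt ds k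

  renEntry : Ren Γ Γ' → Entry Γ τ → Entry Γ' τ
  renEntry r (ren j) = ren (r j)
  renEntry r (tm t) = tm (renT r t)

  wkEntry≡renEntry : ∀ ρs (e : Entry Γ τ) → wkEntry ρs e ≡ renEntry ∈-++⁺ˡ e
  wkEntry≡renEntry ρs (ren j) = refl
  wkEntry≡renEntry ρs (tm t) = refl

  wkEntry-renEntry : ∀ ρs (r : Ren Γ Γ') (e : Entry Γ τ) →
                     wkEntry ρs (renEntry r e) ≡ renEntry (liftRen ρs r) (wkEntry ρs e)
  wkEntry-renEntry {Γ} ρs r (ren j) rewrite ++⁻-ˡ Γ {ρs} j = refl
  wkEntry-renEntry {Γ} ρs r (tm t) =
    cong tm (trans (renT-∘ (λ _ → refl) t) (sym (renT-∘ lift-wk t)))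
    where
      lift-wk : (λ p → liftRen ρs r (∈-++⁺ˡ p)) ≗ʳ (λ p → ∈-++⁺ˡ (r p))
      lift-wk p rewrite ++⁻-ˡ Γ {ρs} p = refl

  liftEnv-renEntry : ∀ ρs {σ : Env Δ Γ} {r : Ren Γ Γ'} {κ : Env Δ Γ'} →
                     κ ≗ᵉ (λ i → renEntry r (σ i)) →
                     liftEnv ρs κ ≗ᵉ (λ p → renEntry (liftRen ρs r) (liftEnv ρs σ p))
  liftEnv-renEntry {Δ} {Γ} ρs {σ} {r} e p with split Δ p
  ... | left q rewrite ++⁻-ˡ Δ {ρs} q | e q = wkEntry-renEntry ρs r (σ q)
  ... | right q rewrite ++⁻-ʳ Δ {ρs} q | ++⁻-ʳ Γ {ρs} q = refl

  liftEnv-liftRen : ∀ ρs {σ : Env Δ' Γ} {r : Ren Δ Δ'} {κ : Env Δ Γ} →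
                    κ ≗ᵉ (λ i → σ (r i)) →
                    liftEnv ρs κ ≗ᵉ (λ p → liftEnv ρs σ (liftRen ρs r p))
  liftEnv-liftRen {Δ'} {Δ = Δ} ρs {r = r} e p with split Δ p
  ... | left q rewrite ++⁻-ˡ Δ {ρs} q | ++⁻-ˡ Δ' {ρs} (r q) = cong (wkEntry ρs) (e q)
  ... | right q rewrite ++⁻-ʳ Δ {ρs} q | ++⁻-ʳ Δ' {ρs} q = refl

  instT-renT : {σ : Env Δ' Γ} {r : Ren Δ Δ'} {κ : Env Δ Γ} → κ ≗ᵉ (λ i → σ (r i)) →
               {t : Tm Δ τ} {t' : Tm Γ τ} → InstT κ t t' → InstT σ (renT r t) t'
  instA-renT : {σ : Env Δ' Γ} {r : Ren Δ Δ'} {κ : Env Δ Γ} → κ ≗ᵉ (λ i → σ (r i)) →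
               {t : Atm Δ a} {t' : Atm Γ a} → InstA κ t t' → InstA σ (renA r t) t'
  instArgs-renT : {σ : Env Δ' Γ} {r : Ren Δ Δ'} {κ : Env Δ Γ} → κ ≗ᵉ (λ i → σ (r i)) →
                  {ts : Args Δ σs} {ts' : Args Γ σs} →
                  InstArgs κ ts ts' → InstArgs σ (renArgs r ts) ts'
  instT-renT {σ = σ} {r} {κ} e (i-lam {σs = σs} d) =
    i-lam (instA-renT (liftEnv-liftRen σs {σ} {r} {κ} e) d)
  instA-renT e (i-ren {i = i} eq d) = i-ren (trans (sym (e i)) eq) (instArgs-renT e d)
  instA-renT e (i-tm {i = i} eq d s) = i-tm (trans (sym (e i)) eq) (instArgs-renT e d) s
  instA-renT e (i-fv d) = i-fv (instArgs-renT e d)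
  instA-renT e (i-fn d) = i-fn (instArgs-renT e d)
  instArgs-renT e i-[] = i-[]
  instArgs-renT e (i-∷ d ds) = i-∷ (instT-renT e d) (instArgs-renT e ds)

  renT-instT : {σ : Env Δ Γ} {r : Ren Γ Γ'} {κ : Env Δ Γ'} → κ ≗ᵉ (λ i → renEntry r (σ i)) →
               {t : Tm Δ τ} {t' : Tm Γ τ} → InstT σ t t' → InstT κ t (renT r t')
  renA-instA : {σ : Env Δ Γ} {r : Ren Γ Γ'} {κ : Env Δ Γ'} → κ ≗ᵉ (λ i → renEntry r (σ i)) →
               {t : Atm Δ a} {t' : Atm Γ a} → InstA σ t t' → InstA κ t (renA r t')
  renArgs-instArgs : {σ : Env Δ Γ} {r : Ren Γ Γ'} {κ : Env Δ Γ'} →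
                     κ ≗ᵉ (λ i → renEntry r (σ i)) → {ts : Args Δ σs} {ts' : Args Γ σs} →
                     InstArgs σ ts ts' → InstArgs κ ts (renArgs r ts')
  renT-instT {σ = σ} {r} {κ} e (i-lam {σs = σs} d) =
    i-lam (renA-instA (liftEnv-renEntry σs {σ} {r} {κ} e) d)
  renA-instA e (i-ren {i = i} eq d) =
    i-ren (trans (e i) (cong (renEntry _) eq)) (renArgs-instArgs e d)
  renA-instA {Γ = Γ} {Γ'} {r = r} e (i-tm {σs = σs} {i = i} {ts' = ts'} eq d s) =
    i-tm (trans (e i) (cong (renEntry r) eq)) (renArgs-instArgs e d)
         (instA-renT (λ _ → refl) (renA-instA ext-ren s))
    where
      ext-ren : (λ p → extEnv (renArgs r ts') (liftRen σs r p)) ≗ᵉ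
                (λ p → renEntry r (extEnv ts' p))
      ext-ren p with split Γ p
      ... | left q rewrite ++⁻-ˡ Γ {σs} q | ++⁻-ˡ Γ' {σs} (r q) = refl
      ... | right q rewrite ++⁻-ʳ Γ {σs} q | ++⁻-ʳ Γ' {σs} q = cong tm (argAt-renArgs r ts' q)
  renA-instA e (i-fv d) = i-fv (renArgs-instArgs e d)
  renA-instA e (i-fn d) = i-fn (renArgs-instArgs e d)
  renArgs-instArgs e i-[] = i-[]
  renArgs-instArgs e (i-∷ d ds) = i-∷ (renT-instT e d) (renArgs-instArgs e ds)

  etaArgs-cong : ∀ ρs {f g : ∀ {σ} → σ ∈ ρs → σ ∈ Δ} → (∀ {σ} (k : σ ∈ ρs) → f k ≡ g k) →
                 etaArgs ρs f ≡ etaArgs ρs g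
  etaArgs-cong [] e = refl
  etaArgs-cong (ρ ∷ ρs) e =
    cong₂ _∷_ (cong (etaT ρ) (e (here refl))) (etaArgs-cong ρs (λ k → e (there k)))

  renT-etaT : (r : Ren Γ Γ') (τ : Type) (j : τ ∈ Γ) → renT r (etaT τ j) ≡ etaT τ (r j)
  renArgs-etaArgs : (r : Ren Γ Γ') (ρs : Ctx) (f : ∀ {σ} → σ ∈ ρs → σ ∈ Γ) →
                    renArgs r (etaArgs ρs f) ≡ etaArgs ρs (λ k → r (f k))
  renT-etaT {Γ} {Γ'} r (ρs ⇒ a) j rewrite ++⁻-ˡ Γ {ρs} j =
    cong (λ ts → lam (app (bv (∈-++⁺ˡ (r j))) ts))
      (trans (renArgs-etaArgs (liftRen ρs r) ρs (∈-++⁺ʳ Γ)) (etaArgs-cong ρs lift-new))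
    where
      lift-new : ∀ {σ} (k : σ ∈ ρs) → liftRen ρs r (∈-++⁺ʳ Γ k) ≡ ∈-++⁺ʳ Γ' k
      lift-new k rewrite ++⁻-ʳ Γ {ρs} k = refl
  renArgs-etaArgs r [] f = refl
  renArgs-etaArgs r (ρ ∷ ρs) f =
    cong₂ _∷_ (renT-etaT r ρ (f (here refl))) (renArgs-etaArgs r ρs (λ k → f (there k)))

  argAt-etaArgs : ∀ ρs (f : ∀ {σ} → σ ∈ ρs → σ ∈ Δ) (k : τ ∈ ρs) →
                  argAt (etaArgs ρs f) k ≡ etaT τ (f k)
  argAt-etaArgs (ρ ∷ ρs) f (here refl) = refl
  argAt-etaArgs (ρ ∷ ρs) f (there k) = argAt-etaArgs ρs (λ q → f (there q)) k

  instT-etaT-ren : (σ : Env Δ Γ) (τ : Type) {i : τ ∈ Δ} {j : τ ∈ Γ} → σ i ≡ ren j →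
                   InstT σ (etaT τ i) (etaT τ j)
  instArgs-etaArgs-ren : (σ : Env Δ Γ) (ρs : Ctx)
                         {f : ∀ {ρ} → ρ ∈ ρs → ρ ∈ Δ} {g : ∀ {ρ} → ρ ∈ ρs → ρ ∈ Γ} →
                         (∀ {ρ} (k : ρ ∈ ρs) → σ (f k) ≡ ren (g k)) →
                         InstArgs σ (etaArgs ρs f) (etaArgs ρs g)
  instT-etaT-ren {Δ} {Γ} σ (ρs ⇒ a) {i} {j} e =
    i-lam (i-ren (trans (liftEnv-ˡ ρs σ i) (cong (wkEntry ρs) e))
                 (instArgs-etaArgs-ren (liftEnv ρs σ) ρs (liftEnv-ʳ ρs σ)))
  instArgs-etaArgs-ren σ [] e = i-[]
  instArgs-etaArgs-ren σ (ρ ∷ ρs) e =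
    i-∷ (instT-etaT-ren σ ρ (e (here refl))) (instArgs-etaArgs-ren σ ρs (λ k → e (there k)))

  EtaRenaming : ℕ → Env Δ Γ → Ren Δ Γ → Set
  EtaRenaming {Δ} n σ r =
    ∀ {τ} (i : τ ∈ Δ) → σ i ≡ ren (r i) ⊎ (σ i ≡ tm (etaT τ (r i)) × size τ < n)

  liftEnv-etaRenaming : ∀ ρs {σ : Env Δ Γ} {r : Ren Δ Γ} → EtaRenaming n σ r →
                        EtaRenaming n (liftEnv ρs σ) (liftRen ρs r)
  liftEnv-etaRenaming {Δ} ρs {σ} {r} ee p with split Δ p
  ... | right q rewrite ++⁻-ʳ Δ {ρs} q = inj₁ refl
  ... | left {τ} q rewrite ++⁻-ˡ Δ {ρs} q with ee q
  ...   | inj₁ eq rewrite eq = inj₁ refl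
  ...   | inj₂ (eq , lt) rewrite eq = inj₂ (cong tm (renT-etaT ∈-++⁺ˡ τ (r q)) , lt)

  instT-etaRenaming : (σ : Env Δ Γ) (r : Ren Δ Γ) → EtaRenaming n σ r →
                      (t : Tm Δ τ) → InstT σ t (renT r t)
  instA-etaRenaming : (σ : Env Δ Γ) (r : Ren Δ Γ) → EtaRenaming n σ r →
                      (t : Atm Δ a) → InstA σ t (renA r t)
  instArgs-etaRenaming : (σ : Env Δ Γ) (r : Ren Δ Γ) → EtaRenaming n σ r →
                         (ts : Args Δ σs) → InstArgs σ ts (renArgs r ts)
  instT-etaT : (σ : Env Δ Γ) (τ : Type) {i : τ ∈ Δ} {t : Tm Γ τ} → size τ ≤ n → σ i ≡ tm t →
               InstT σ (etaT τ i) t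
  instArgs-etaArgs : (σ : Env Δ Γ) (ρs : Ctx) {f : ∀ {ρ} → ρ ∈ ρs → ρ ∈ Δ} {ts : Args Γ ρs} →
                     sizes ρs ≤ n → (∀ {ρ} (k : ρ ∈ ρs) → σ (f k) ≡ tm (argAt ts k)) →
                     InstArgs σ (etaArgs ρs f) ts
  instT-etaRenaming σ r ee (lam {σs} b) =
    i-lam (instA-etaRenaming (liftEnv σs σ) (liftRen σs r) (liftEnv-etaRenaming σs ee) b)
  instA-etaRenaming σ r ee (app (bv i) ts) with ee i
  ... | inj₁ eq = i-ren eq (instArgs-etaRenaming σ r ee ts)
  instA-etaRenaming {n = zero} σ r ee (app (bv i) ts) | inj₂ (_ , ())
  instA-etaRenaming {Γ = Γ} {n = suc n} σ r ee (app (bv {σs ⇒ a} i) ts) | inj₂ (eq , lt) =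
    i-tm eq (instArgs-etaRenaming σ r ee ts)
      (i-ren (extEnv-ˡ rts (r i))
             (instArgs-etaArgs (extEnv rts) σs (<⇒≤ (≤-pred lt)) (extEnv-ʳ rts)))
    where
      rts : Args Γ σs
      rts = renArgs r ts
  instA-etaRenaming σ r ee (app (fv x) ts) = i-fv (instArgs-etaRenaming σ r ee ts)
  instA-etaRenaming σ r ee (app (fn f) ts) = i-fn (instArgs-etaRenaming σ r ee ts)
  instArgs-etaRenaming σ r ee [] = i-[]
  instArgs-etaRenaming σ r ee (t ∷ ts) =
    i-∷ (instT-etaRenaming σ r ee t) (instArgs-etaRenaming σ r ee ts)
  instT-etaT {Δ} {Γ} {n} σ (ρs ⇒ a) {i} {lam w} le eq =
    i-lam (i-tm lifted (instArgs-etaArgs-ren (liftEnv ρs σ) ρs (liftEnv-ʳ ρs σ)) body)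
    where
      lifted : liftEnv ρs σ (∈-++⁺ˡ i) ≡ tm (lam (renA (liftRen ρs ∈-++⁺ˡ) w))
      lifted = trans (liftEnv-ˡ ρs σ i) (cong (wkEntry ρs) eq)
      κ : Env (Γ ++ ρs) (Γ ++ ρs)
      κ p = extEnv (etaBlock ρs) (liftRen ρs ∈-++⁺ˡ p)
      κ-eta : EtaRenaming n κ (λ p → p)
      κ-eta p with split Γ p
      ... | left q rewrite ++⁻-ˡ Γ {ρs} q | ++⁻-ˡ (Γ ++ ρs) {ρs} (∈-++⁺ˡ {ys = ρs} q) = inj₁ refl
      ... | right q rewrite ++⁻-ʳ Γ {ρs} q | ++⁻-ʳ (Γ ++ ρs) {ρs} q =
        inj₂ (cong tm (argAt-etaArgs ρs (∈-++⁺ʳ Γ) q) , <-≤-trans (s≤s (∈⇒size≤sizes q)) le)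
      body : InstA (extEnv (etaBlock ρs)) (renA (liftRen ρs ∈-++⁺ˡ) w) w
      body = instA-renT (λ _ → refl)
               (subst (InstA κ w) (renA-id (λ _ → refl) w)
                      (instA-etaRenaming κ (λ p → p) κ-eta w))
  instArgs-etaArgs σ [] {ts = []} le e = i-[]
  instArgs-etaArgs σ (ρ ∷ ρs) {ts = t ∷ ts} le e =
    i-∷ (instT-etaT σ ρ (≤-trans (m≤m+n _ _) le) (e (here refl)))
        (instArgs-etaArgs σ ρs (≤-trans (m≤n+m _ (size ρ)) le) (λ k → e (there k)))

  instT-etaRenaming-id : (σ : Env Δ Δ) → EtaRenaming n σ (λ p → p) → (t : Tm Δ τ) → InstT σ t t
  instT-etaRenaming-id σ ee t =
    subst (InstT σ t) (renT-id (λ _ → refl) t) (instT-etaRenaming σ (λ p → p) ee t)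

  instA-etaRenaming-id : (σ : Env Δ Δ) → EtaRenaming n σ (λ p → p) → (t : Atm Δ a) → InstA σ t t
  instA-etaRenaming-id σ ee t =
    subst (InstA σ t) (renA-id (λ _ → refl) t) (instA-etaRenaming σ (λ p → p) ee t)

  instT-extEnv-wk : (ts : Args Γ zs) (t : Tm Γ τ) → InstT (extEnv ts) (renT ∈-++⁺ˡ t) t
  instT-extEnv-wk ts t =
    instT-renT (λ _ → refl) (instT-etaRenaming-id {n = 0} _ (λ p → inj₁ (extEnv-ˡ ts p)) t)

  data InstEntry (ψ : Env Γ Θ) {σ : Type} : Entry Γ σ → Entry Θ σ → Set where
    inst-ren : ∀ {j : σ ∈ Γ} {e} → ψ j ≡ e → InstEntry ψ (ren j) e
    inst-tm  : ∀ {t t'} → InstT ψ t t' → InstEntry ψ (tm t) (tm t')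

  instEntry-ren : {ψ : Env Γ Θ} {j : σ ∈ Γ} {e : Entry Γ σ} {e' : Entry Θ σ} →
                  InstEntry ψ e e' → e ≡ ren j → e' ≡ ψ j
  instEntry-ren (inst-ren ψj≡) refl = sym ψj≡

  instEntry-lam : {ψ : Env Γ Θ} {w : Atm (Γ ++ zs) a}
                  {e : Entry Γ (zs ⇒ a)} {e' : Entry Θ (zs ⇒ a)} →
                  InstEntry ψ e e' → e ≡ tm (lam w) →
                  ∃[ w' ] (e' ≡ tm (lam w') × InstA (liftEnv zs ψ) w w')
  instEntry-lam (inst-tm (i-lam d)) refl = _ , refl , d

  InstEnv : Env Γ Θ → Env Δ Γ → Env Δ Θ → Set
  InstEnv {Δ = Δ} ψ φ χ = ∀ {σ} (i : σ ∈ Δ) → InstEntry ψ (φ i) (χ i)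

  wkEntry-instEntry : ∀ zs {ψ : Env Γ Θ} {e : Entry Γ σ} {e'} → InstEntry ψ e e' →
                      InstEntry (liftEnv zs ψ) (wkEntry zs e) (wkEntry zs e')
  wkEntry-instEntry zs {ψ} (inst-ren {j} refl) = inst-ren (liftEnv-ˡ zs ψ j)
  wkEntry-instEntry zs {ψ} (inst-tm d) =
    inst-tm (instT-renT (λ i → sym (liftEnv-ˡ zs ψ i))
                        (renT-instT (λ i → wkEntry≡renEntry zs (ψ i)) d))

  liftEnv-instEnv : ∀ zs {ψ : Env Γ Θ} {φ : Env Δ Γ} {χ : Env Δ Θ} → InstEnv ψ φ χ →
                    InstEnv (liftEnv zs ψ) (liftEnv zs φ) (liftEnv zs χ)
  liftEnv-instEnv {Δ = Δ} zs {ψ} c p with split Δ p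
  ... | left q rewrite ++⁻-ˡ Δ {zs} q = wkEntry-instEntry zs (c q)
  ... | right q rewrite ++⁻-ʳ Δ {zs} q = inst-ren (liftEnv-ʳ zs ψ q)

  extendEnv : Env Γ Θ → Args Θ zs → Env (Γ ++ zs) Θ
  extendEnv {Γ} ψ ts p = [ ψ , (λ q → tm (argAt ts q)) ]′ (∈-++⁻ Γ p)

  extEnv-instEnv : {ψ : Env Γ Θ} {ts : Args Γ zs} {ts' : Args Θ zs} → InstArgs ψ ts ts' →
                   InstEnv ψ (extEnv ts) (extendEnv ψ ts')
  extEnv-instEnv {Γ} {zs = zs} d p with split Γ p
  ... | left q rewrite ++⁻-ˡ Γ {zs} q = inst-ren refl
  ... | right q rewrite ++⁻-ʳ Γ {zs} q = inst-tm (instArgs-argAt d q)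

  liftEnv-extEnv-instEnv : (ψ : Env Γ Θ) (ts : Args Θ zs) →
                           InstEnv (extEnv ts) (liftEnv zs ψ) (extendEnv ψ ts)
  liftEnv-extEnv-instEnv {Γ} {zs = zs} ψ ts p with split Γ p
  ... | right q rewrite ++⁻-ʳ Γ {zs} q = inst-ren (extEnv-ʳ ts q)
  ... | left q rewrite ++⁻-ˡ Γ {zs} q with ψ q
  ...   | ren k = inst-ren (extEnv-ˡ ts k)
  ...   | tm t = inst-tm (instT-extEnv-wk ts t)

  instT-∘ : {φ : Env Δ Γ} {ψ : Env Γ Θ} {χ : Env Δ Θ} {nφ nψ : ℕ} →
            Bounded nφ φ → Bounded nψ ψ → nφ + nψ ≤ n → InstEnv ψ φ χ →
            {t : Tm Δ τ} {t₁ : Tm Γ τ} {t₂ : Tm Θ τ} →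
            InstT φ t t₁ → InstT ψ t₁ t₂ → InstT χ t t₂
  instA-∘ : {φ : Env Δ Γ} {ψ : Env Γ Θ} {χ : Env Δ Θ} {nφ nψ : ℕ} →
            Bounded nφ φ → Bounded nψ ψ → nφ + nψ ≤ n → InstEnv ψ φ χ →
            {t : Atm Δ a} {t₁ : Atm Γ a} {t₂ : Atm Θ a} →
            InstA φ t t₁ → InstA ψ t₁ t₂ → InstA χ t t₂
  instArgs-∘ : {φ : Env Δ Γ} {ψ : Env Γ Θ} {χ : Env Δ Θ} {nφ nψ : ℕ} →
               Bounded nφ φ → Bounded nψ ψ → nφ + nψ ≤ n → InstEnv ψ φ χ →
               {ts : Args Δ σs} {ts₁ : Args Γ σs} {ts₂ : Args Θ σs} →
               InstArgs φ ts ts₁ → InstArgs ψ ts₁ ts₂ → InstArgs χ ts ts₂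
  instT-∘ bφ bψ le c (i-lam {σs = zs} d₁) (i-lam d₂) =
    i-lam (instA-∘ (liftEnv-bounded zs bφ) (liftEnv-bounded zs bψ) le (liftEnv-instEnv zs c) d₁ d₂)
  instA-∘ bφ bψ le c (i-ren {i = i} eq d₁) (i-ren ψj≡ ds₂) =
    i-ren (trans (instEntry-ren (c i) eq) ψj≡) (instArgs-∘ bφ bψ le c d₁ ds₂)
  instA-∘ bφ bψ le c (i-ren {i = i} eq d₁) (i-tm ψj≡ ds₂ s₂) =
    i-tm (trans (instEntry-ren (c i) eq) ψj≡) (instArgs-∘ bφ bψ le c d₁ ds₂) s₂
  instA-∘ {n = zero} {nψ = nψ} bφ bψ le c (i-tm {i = i} eq _ _) _
    with () ← ≤-trans (bφ i eq) (≤-trans (m≤m+n _ nψ) le)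
  -- t₂ and r are both w instantiated by extendEnv ψ ts₂, reached along the two
  -- routes below; the type zs ⇒ a of the redex bounds both measures.
  instA-∘ {n = suc n} {ψ = ψ} {nψ = nψ} bφ bψ le c {t₂ = t₂}
          (i-tm {σs = zs} {a} {i = i} {ts' = ts₁} eq d₁ w↦t₁) t₁↦t₂ =
    let w' , χi≡ , w↦w' = instEntry-lam (c i) eq
        ts₂ , ds₂ = instArgs-total ψ bψ ts₁
        r , w'↦r = instA-total (extEnv ts₂) (extEnv-bounded ts₂) w'
        t₂≡r : t₂ ≡ r
        t₂≡r = instA-det
          (instA-∘ (extEnv-bounded ts₁) bψ measure₁ (extEnv-instEnv ds₂) w↦t₁ t₁↦t₂)
          (instA-∘ (liftEnv-bounded zs bψ) (extEnv-bounded ts₂) measure₂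
                   (liftEnv-extEnv-instEnv ψ ts₂) w↦w' w'↦r)
    in i-tm χi≡ (instArgs-∘ bφ bψ le c d₁ ds₂) (subst (InstA (extEnv ts₂) w') (sym t₂≡r) w'↦r)
    where
      measure₁ : size (zs ⇒ a) + nψ ≤ n
      measure₁ = ≤-pred (≤-trans (+-monoˡ-≤ nψ (bφ i eq)) le)
      measure₂ : nψ + size (zs ⇒ a) ≤ n
      measure₂ = subst (_≤ n) (+-comm _ nψ) measure₁
  instA-∘ bφ bψ le c (i-fv d₁) (i-fv d₂) = i-fv (instArgs-∘ bφ bψ le c d₁ d₂)
  instA-∘ bφ bψ le c (i-fn d₁) (i-fn d₂) = i-fn (instArgs-∘ bφ bψ le c d₁ d₂)
  instArgs-∘ bφ bψ le c i-[] i-[] = i-[]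
  instArgs-∘ bφ bψ le c (i-∷ d₁ ds₁) (i-∷ d₂ ds₂) =
    i-∷ (instT-∘ bφ bψ le c d₁ d₂) (instArgs-∘ bφ bψ le c ds₁ ds₂)

  private variable
    θ γ δ η : Subst

  appT-total : (θ : Subst) (t : Tm Γ τ) → ∃[ t' ] AppT θ t t'
  appA-total : (θ : Subst) (t : Atm Γ a) → ∃[ t' ] AppA θ t t'
  appArgs-total : (θ : Subst) (ts : Args Γ σs) → ∃[ ts' ] AppArgs θ ts ts'
  appT-total θ (lam w) with appA-total θ w
  ... | w' , d = lam w' , a-lam d
  appA-total θ (app (bv i) ts) with appArgs-total θ ts
  ... | ts' , d = app (bv i) ts' , a-bv d
  appA-total θ (app (fn f) ts) with appArgs-total θ ts
  ... | ts' , d = app (fn f) ts' , a-fn d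
  appA-total θ (app (fv x) ts) with at θ x in θx≡ | appArgs-total θ ts
  ... | nothing | ts' , d = app (fv x) ts' , a-fv₀ θx≡ d
  ... | just (lam u) | ts' , d with instA-total (argsEnv ts') (argsEnv-bounded ts') u
  ...   | r , d' = r , a-fv₁ θx≡ d d'
  appArgs-total θ [] = [] , a-[]
  appArgs-total θ (t ∷ ts) with appT-total θ t | appArgs-total θ ts
  ... | t' , d | ts' , ds = t' ∷ ts' , a-∷ d ds

  appT-det : {t t₁ t₂ : Tm Γ τ} → AppT θ t t₁ → AppT θ t t₂ → t₁ ≡ t₂
  appA-det : {t t₁ t₂ : Atm Γ a} → AppA θ t t₁ → AppA θ t t₂ → t₁ ≡ t₂
  appArgs-det : {ts ts₁ ts₂ : Args Γ σs} → AppArgs θ ts ts₁ → AppArgs θ ts ts₂ → ts₁ ≡ ts₂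
  appT-det (a-lam d₁) (a-lam d₂) = cong lam (appA-det d₁ d₂)
  appA-det (a-bv d₁) (a-bv d₂) = cong (app (bv _)) (appArgs-det d₁ d₂)
  appA-det (a-fn d₁) (a-fn d₂) = cong (app (fn _)) (appArgs-det d₁ d₂)
  appA-det (a-fv₀ _ d₁) (a-fv₀ _ d₂) = cong (app (fv _)) (appArgs-det d₁ d₂)
  appA-det (a-fv₀ e₁ _) (a-fv₁ e₂ _ _) with () ← trans (sym e₁) e₂
  appA-det (a-fv₁ e₁ _ _) (a-fv₀ e₂ _) with () ← trans (sym e₁) e₂
  appA-det (a-fv₁ e₁ d₁ s₁) (a-fv₁ e₂ d₂ s₂)
    with refl ← trans (sym e₁) e₂ | refl ← appArgs-det d₁ d₂ = instA-det s₁ s₂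
  appArgs-det a-[] a-[] = refl
  appArgs-det (a-∷ d₁ ds₁) (a-∷ d₂ ds₂) = cong₂ _∷_ (appT-det d₁ d₂) (appArgs-det ds₁ ds₂)

  appArgs-argAt : {ts ts' : Args Γ σs} → AppArgs θ ts ts' → (k : τ ∈ σs) →
                  AppT θ (argAt ts k) (argAt ts' k)
  appArgs-argAt (a-∷ d ds) (here refl) = d
  appArgs-argAt (a-∷ d ds) (there k) = appArgs-argAt ds k

  appT-renT : (r : Ren Γ Γ') {t t' : Tm Γ τ} → AppT θ t t' → AppT θ (renT r t) (renT r t')
  appA-renA : (r : Ren Γ Γ') {t t' : Atm Γ a} → AppA θ t t' → AppA θ (renA r t) (renA r t')
  appArgs-renArgs : (r : Ren Γ Γ') {ts ts' : Args Γ σs} → AppArgs θ ts ts' →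
                    AppArgs θ (renArgs r ts) (renArgs r ts')
  appT-renT r (a-lam {σs = σs} d) = a-lam (appA-renA (liftRen σs r) d)
  appA-renA r (a-bv d) = a-bv (appArgs-renArgs r d)
  appA-renA r (a-fn d) = a-fn (appArgs-renArgs r d)
  appA-renA r (a-fv₀ eq d) = a-fv₀ eq (appArgs-renArgs r d)
  appA-renA r (a-fv₁ {ts' = ts'} eq d s) =
    a-fv₁ eq (appArgs-renArgs r d) (renA-instA (λ i → cong tm (argAt-renArgs r ts' i)) s)
  appArgs-renArgs r a-[] = a-[]
  appArgs-renArgs r (a-∷ d ds) = a-∷ (appT-renT r d) (appArgs-renArgs r ds)

  appT-id : (t : Tm Γ τ) → (∀ x → x ∈fvT t → at θ x ≡ nothing) → AppT θ t t
  appA-id : (t : Atm Γ a) → (∀ x → x ∈fvA t → at θ x ≡ nothing) → AppA θ t t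
  appArgs-id : (ts : Args Γ σs) → (∀ x → x ∈fvArgs ts → at θ x ≡ nothing) → AppArgs θ ts ts
  appT-id (lam b) h = a-lam (appA-id b (λ x p → h x (fv-lam p)))
  appA-id (app (bv i) ts) h = a-bv (appArgs-id ts (λ x p → h x (fv-arg p)))
  appA-id (app (fn f) ts) h = a-fn (appArgs-id ts (λ x p → h x (fv-arg p)))
  appA-id (app (fv x) ts) h = a-fv₀ (h x fv-hd) (appArgs-id ts (λ y p → h y (fv-arg p)))
  appArgs-id [] h = a-[]
  appArgs-id (t ∷ ts) h =
    a-∷ (appT-id t (λ x p → h x (fv-here p))) (appArgs-id ts (λ x p → h x (fv-there p)))

  appT-etaT : (τ : Type) (i : τ ∈ Γ) → AppT θ (etaT τ i) (etaT τ i)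
  appArgs-etaArgs : (ρs : Ctx) (f : ∀ {ρ} → ρ ∈ ρs → ρ ∈ Γ) →
                    AppArgs θ (etaArgs ρs f) (etaArgs ρs f)
  appT-etaT {Γ} (ρs ⇒ a) i = a-lam (a-bv (appArgs-etaArgs ρs (∈-++⁺ʳ Γ)))
  appArgs-etaArgs [] f = a-[]
  appArgs-etaArgs (ρ ∷ ρs) f =
    a-∷ (appT-etaT ρ (f (here refl))) (appArgs-etaArgs ρs (λ k → f (there k)))

  data AppEntry {Γ : Ctx} (γ : Subst) {σ : Type} : Entry Γ σ → Entry Γ σ → Set where
    app-ren : ∀ {j : σ ∈ Γ} → AppEntry γ (ren j) (ren j)
    app-tm  : ∀ {t t'} → AppT γ t t' → AppEntry γ (tm t) (tm t')

  appEntry-ren : {j : σ ∈ Γ} {e e' : Entry Γ σ} → AppEntry γ e e' → e ≡ ren j → e' ≡ ren j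
  appEntry-ren app-ren refl = refl

  appEntry-lam : {w : Atm (Γ ++ zs) a} {e e' : Entry Γ (zs ⇒ a)} →
                 AppEntry γ e e' → e ≡ tm (lam w) → ∃[ w' ] (e' ≡ tm (lam w') × AppA γ w w')
  appEntry-lam (app-tm (a-lam d)) refl = _ , refl , d

  AppEnv : Subst → Env Δ Γ → Env Δ Γ → Set
  AppEnv {Δ} γ σ σ' = ∀ {τ} (i : τ ∈ Δ) → AppEntry γ (σ i) (σ' i)

  wkEntry-appEntry : ∀ zs {e e' : Entry Γ σ} → AppEntry γ e e' →
                     AppEntry γ (wkEntry zs e) (wkEntry zs e')
  wkEntry-appEntry zs app-ren = app-ren
  wkEntry-appEntry zs (app-tm d) = app-tm (appT-renT ∈-++⁺ˡ d)

  liftEnv-appEnv : ∀ zs {σ σ' : Env Δ Γ} → AppEnv γ σ σ' → AppEnv γ (liftEnv zs σ) (liftEnv zs σ')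
  liftEnv-appEnv {Δ} zs ae p with split Δ p
  ... | left q rewrite ++⁻-ˡ Δ {zs} q = wkEntry-appEntry zs (ae q)
  ... | right q rewrite ++⁻-ʳ Δ {zs} q = app-ren

  extEnv-appEnv : {ts ts' : Args Γ zs} → AppArgs γ ts ts' → AppEnv γ (extEnv ts) (extEnv ts')
  extEnv-appEnv {Γ} {zs} d p with split Γ p
  ... | left q rewrite ++⁻-ˡ Γ {zs} q = app-ren
  ... | right q rewrite ++⁻-ʳ Γ {zs} q = app-tm (appArgs-argAt d q)

  appT-instT : {σ σ' : Env Δ Γ} → AppEnv γ σ σ' → Bounded n σ' →
               {w w' : Tm Δ τ} {t₁ t₂ : Tm Γ τ} →
               InstT σ w t₁ → AppT γ t₁ t₂ → AppT γ w w' → InstT σ' w' t₂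
  appA-instA : {σ σ' : Env Δ Γ} → AppEnv γ σ σ' → Bounded n σ' →
               {w w' : Atm Δ a} {t₁ t₂ : Atm Γ a} →
               InstA σ w t₁ → AppA γ t₁ t₂ → AppA γ w w' → InstA σ' w' t₂
  appArgs-instArgs : {σ σ' : Env Δ Γ} → AppEnv γ σ σ' → Bounded n σ' →
                     {ws ws' : Args Δ σs} {ts₁ ts₂ : Args Γ σs} →
                     InstArgs σ ws ts₁ → AppArgs γ ts₁ ts₂ → AppArgs γ ws ws' → InstArgs σ' ws' ts₂
  appT-instT ae b (i-lam {σs = zs} d) (a-lam d₂) (a-lam dw) =
    i-lam (appA-instA (liftEnv-appEnv zs ae) (liftEnv-bounded zs b) d d₂ dw)
  appA-instA ae b (i-ren {i = i} eq d) (a-bv d₂) (a-bv dw) =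
    i-ren (appEntry-ren (ae i) eq) (appArgs-instArgs ae b d d₂ dw)
  appA-instA {γ = γ} ae b (i-tm {i = i} {ts' = ts₁} eq d s) d₂ (a-bv dw) =
    let v' , σ'i≡ , v↦v' = appEntry-lam (ae i) eq
        ts₂ , ds₂ = appArgs-total γ ts₁
    in i-tm σ'i≡ (appArgs-instArgs ae b d ds₂ dw)
            (appA-instA (extEnv-appEnv ds₂) (extEnv-bounded ts₂) s d₂ v↦v')
  appA-instA ae b (i-fv d) (a-fv₀ _ d₂) (a-fv₀ _ dw) = i-fv (appArgs-instArgs ae b d d₂ dw)
  appA-instA ae b (i-fv d) (a-fv₀ e₂ _) (a-fv₁ ew _ _) with () ← trans (sym e₂) ew
  appA-instA ae b (i-fv d) (a-fv₁ e₂ _ _) (a-fv₀ ew _) with () ← trans (sym e₂) ew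
  appA-instA {σ' = σ'} ae b {w' = w'} (i-fv d) (a-fv₁ e₂ d₂ u↦t₂) (a-fv₁ {ts' = ws'} ew dw u↦w')
    with refl ← trans (sym e₂) ew =
    let r , w'↦r = instA-total σ' b w'
        args↦ = appArgs-instArgs ae b d d₂ dw
        u↦r = instA-∘ (argsEnv-bounded ws') b ≤-refl
                      (λ i → inst-tm (instArgs-argAt args↦ i)) u↦w' w'↦r
    in subst (InstA σ' w') (instA-det u↦r u↦t₂) w'↦r
  appA-instA ae b (i-fn d) (a-fn d₂) (a-fn dw) = i-fn (appArgs-instArgs ae b d d₂ dw)
  appArgs-instArgs ae b i-[] a-[] a-[] = i-[]
  appArgs-instArgs ae b (i-∷ d ds) (a-∷ d₂ ds₂) (a-∷ dw dsw) =
    i-∷ (appT-instT ae b d d₂ dw) (appArgs-instArgs ae b ds ds₂ dsw)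

  appT-∘ : IsComp δ γ η → {t t₁ t₂ : Tm Γ τ} → AppT δ t t₁ → AppT γ t₁ t₂ → AppT η t t₂
  appA-∘ : IsComp δ γ η → {t t₁ t₂ : Atm Γ a} → AppA δ t t₁ → AppA γ t₁ t₂ → AppA η t t₂
  appArgs-∘ : IsComp δ γ η → {ts ts₁ ts₂ : Args Γ σs} →
              AppArgs δ ts ts₁ → AppArgs γ ts₁ ts₂ → AppArgs η ts ts₂
  appT-∘ c (a-lam d₁) (a-lam d₂) = a-lam (appA-∘ c d₁ d₂)
  appA-∘ c (a-bv d₁) (a-bv d₂) = a-bv (appArgs-∘ c d₁ d₂)
  appA-∘ c (a-fn d₁) (a-fn d₂) = a-fn (appArgs-∘ c d₁ d₂)
  appA-∘ c (a-fv₀ {x = x} δx≡ d₁) (a-fv₀ γx≡ d₂) =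
    a-fv₀ (trans (IsComp.comp-out c x δx≡) γx≡) (appArgs-∘ c d₁ d₂)
  appA-∘ c (a-fv₀ {x = x} δx≡ d₁) (a-fv₁ γx≡ d₂ s₂) =
    a-fv₁ (trans (IsComp.comp-out c x δx≡) γx≡) (appArgs-∘ c d₁ d₂) s₂
  appA-∘ {γ = γ} c (a-fv₁ {x = x} {ts' = ts₁} δx≡ d₁ s₁) d₂ with IsComp.comp-in c x δx≡
  ... | lam u' , a-lam u↦u' , ηx≡ =
    let ts₂ , ds₂ = appArgs-total γ ts₁
    in a-fv₁ ηx≡ (appArgs-∘ c d₁ ds₂)
         (appA-instA (λ i → app-tm (appArgs-argAt ds₂ i)) (argsEnv-bounded ts₂) s₁ d₂ u↦u')
  appArgs-∘ c a-[] a-[] = a-[]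
  appArgs-∘ c (a-∷ d₁ ds₁) (a-∷ d₂ ds₂) = a-∷ (appT-∘ c d₁ d₂) (appArgs-∘ c ds₁ ds₂)

  private variable
    E E₁ E₂ : List Pair
    q : Pair

  Unifies : Subst → Pair → Set
  Unifies θ (τ , s , t) = ∃[ u ] (AppT θ s u × AppT θ t u)

  unifies-refl : (s : Tm [] τ) → Unifies θ (s ≈ s)
  unifies-refl {θ = θ} s = let u , d = appT-total θ s in u , d , d

  unifies-∘ : IsComp δ γ η → Unifies δ q → Unifies η q
  unifies-∘ {γ = γ} c (u , d₁ , d₂) =
    let u' , d = appT-total γ u in u' , appT-∘ c d₁ d , appT-∘ c d₂ d

  ∈𝒰-Picks : {s t : Tm [] τ} → Picks E₁ s t E → Unifies η (s ≈ t) → η ∈𝒰 E → η ∈𝒰 E₁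
  ∈𝒰-Picks (inj₁ E₁↭) (u , ds , dt) η∈𝒰E m with ∈-resp-↭ E₁↭ m
  ... | here refl = u , ds , dt
  ... | there m' = η∈𝒰E m'
  ∈𝒰-Picks (inj₂ E₁↭) (u , ds , dt) η∈𝒰E m with ∈-resp-↭ E₁↭ m
  ... | here refl = u , dt , ds
  ... | there m' = η∈𝒰E m'

  ∈𝒰-AppE : IsComp δ γ η → AppE δ E E₂ → γ ∈𝒰 E₂ → η ∈𝒰 E
  ∈𝒰-AppE c (app-pair ds dt ∷ _) γ∈𝒰 (here refl) =
    let u , ds' , dt' = γ∈𝒰 (here refl) in u , appT-∘ c ds ds' , appT-∘ c dt dt'
  ∈𝒰-AppE c (_ ∷ Eδ) γ∈𝒰 (there m) = ∈𝒰-AppE c Eδ (λ m' → γ∈𝒰 (there m')) m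

  appE-empty : IsEmpty δ → (E : List Pair) → AppE δ E E
  appE-empty empty [] = []
  appE-empty empty ((τ , s , t) ∷ E) =
    app-pair (appT-id s (λ x _ → empty x)) (appT-id t (λ x _ → empty x)) ∷ appE-empty empty E

  picked-DHP : {s t : Tm [] τ} → DHPProblem E₁ → Picks E₁ s t E → DHP s × DHP t
  picked-DHP dhp (inj₁ E₁↭) = dhp (∈-resp-↭ (↭-sym E₁↭) (here refl))
  picked-DHP dhp (inj₂ E₁↭) =
    let dhp-t , dhp-s = dhp (∈-resp-↭ (↭-sym E₁↭) (here refl)) in dhp-s , dhp-t

  zipBind-unifies : {ss ts : Args Δ σs} → η ∈𝒰 zipBind ss ts →
                    ∃[ us ] (AppArgs η ss us × AppArgs η ts us)
  zipBind-unifies {ss = []} {[]} _ = [] , a-[] , a-[]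
  zipBind-unifies {ss = lam _ ∷ ss} {lam _ ∷ ts} η∈𝒰
    with η∈𝒰 (here refl) | zipBind-unifies {ss = ss} {ts} (λ m → η∈𝒰 (there m))
  ... | lam u , a-lam ds , a-lam dt | us , dss , dts =
    lam u ∷ us , a-∷ (a-lam ds) dss , a-∷ (a-lam dt) dts

  decompose-unifies : {h : Head Δ (σs ⇒ a)} {ss ts : Args Δ σs} → Rigid h →
                      η ∈𝒰 zipBind ss ts → Unifies η (top (app h ss) ≈ top (app h ts))
  decompose-unifies {ss = ss} {ts} rigid-bv η∈𝒰 =
    let _ , dss , dts = zipBind-unifies {ss = ss} {ts} η∈𝒰 in _ , a-lam (a-bv dss) , a-lam (a-bv dts)
  decompose-unifies {ss = ss} {ts} rigid-fn η∈𝒰 =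
    let _ , dss , dts = zipBind-unifies {ss = ss} {ts} η∈𝒰 in _ , a-lam (a-fn dss) , a-lam (a-fn dts)

  eliminate-unifies : ∀ {k} {u : Tm [] (Δ ⇒ a)} → let F = mkVar k Δ a in
                      Maps1 δ F u → ¬ (F ∈fvT u) → Unifies δ (top (app (fv F) (etaAll Δ)) ≈ u)
  eliminate-unifies {Δ} {u = lam w} (δF≡ , δ-else) F∉u =
    lam w ,
    a-lam (a-fv₁ δF≡ (appArgs-etaArgs Δ (λ p → p)) (instA-etaRenaming-id _ etaAll-etaRenaming w)) ,
    appT-id (lam w) (λ x x∈u → δ-else x (λ { refl → F∉u x∈u }))
    where
      etaAll-etaRenaming : EtaRenaming (suc (sizes Δ)) (argsEnv (etaAll Δ)) (λ p → p)
      etaAll-etaRenaming i = inj₂ (cong tm (argAt-etaArgs Δ (λ p → p) i) , s≤s (∈⇒size≤sizes i))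

  selArgs : Sel σs ρs → Args Γ σs → Args Γ ρs
  selArgs done [] = []
  selArgs (keep sel) (t ∷ ts) = t ∷ selArgs sel ts
  selArgs (skip sel) (t ∷ ts) = selArgs sel ts

  argAt-selArgs : (sel : Sel σs ρs) (ts : Args Γ σs) (k : τ ∈ ρs) →
                  argAt (selArgs sel ts) k ≡ argAt ts (selVar sel k)
  argAt-selArgs (keep sel) (t ∷ ts) (here refl) = refl
  argAt-selArgs (keep sel) (t ∷ ts) (there k) = argAt-selArgs sel ts k
  argAt-selArgs (skip sel) (t ∷ ts) k = argAt-selArgs sel ts k

  selEq-selArgs : {sel : Sel σs ρs} {ss ts ss' ts' : Args Γ σs} → SelEq sel ss ts →
                  AppArgs θ ss ss' → AppArgs θ ts ts' → selArgs sel ss' ≡ selArgs sel ts'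
  selEq-selArgs se-done a-[] a-[] = refl
  selEq-selArgs (se-keep se) (a-∷ d ds) (a-∷ d' ds') =
    cong₂ _∷_ (appT-det d d') (selEq-selArgs se ds ds')
  selEq-selArgs (se-skip _ se) (a-∷ _ ds) (a-∷ _ ds') = selEq-selArgs se ds ds'

  sameBinding : ℕ → Sel σs ρs → Tm [] (σs ⇒ a)
  sameBinding {ρs = ρs} {a} m sel = top (app (fv (mkVar m ρs a)) (etaArgs ρs (selVar sel)))

  appT-sameBinding : ∀ {k m} (sel : Sel σs ρs) {zs zs' : Args Δ σs} →
                     Maps1 δ (mkVar k σs a) (sameBinding m sel) → AppArgs δ zs zs' →
                     AppT δ (top (app (fv (mkVar k σs a)) zs))
                            (top (app (fv (mkVar m ρs a)) (selArgs sel zs')))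
  appT-sameBinding {ρs = ρs} sel {zs' = zs'} (δF≡ , _) d =
    a-lam (a-fv₁ δF≡ d (i-fv (instArgs-etaArgs (argsEnv zs') ρs ≤-refl
                                 (λ k → cong tm (sym (argAt-selArgs sel zs' k))))))

  same-unifies : ∀ {k m} (sel : Sel σs ρs) {ss ts : Args Δ σs} → SelEq sel ss ts →
                 Maps1 δ (mkVar k σs a) (sameBinding m sel) →
                 Unifies δ (top (app (fv (mkVar k σs a)) ss) ≈ top (app (fv (mkVar k σs a)) ts))
  same-unifies {δ = δ} sel {ss} {ts} se maps =
    let ss' , dss = appArgs-total δ ss
        ts' , dts = appArgs-total δ ts
    in _ , appT-sameBinding sel maps dss
         , subst (λ us → AppT δ _ (top (app (fv _) us))) (sym (selEq-selArgs se dss dts))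
                 (appT-sameBinding sel maps dts)

  fvArgs-argAt : ∀ {x} {ts : Args Γ σs} → x ∈fvArgs ts → ∃[ τ ] Σ (τ ∈ σs) λ k → x ∈fvT argAt ts k
  fvArgs-argAt (fv-here p) = _ , here refl , p
  fvArgs-argAt (fv-there p) = let τ , k , q = fvArgs-argAt p in τ , there k , q

  -- Condition (i): the arguments of a flex head are closed.
  DHP-flex-args : ∀ {x} {ts : Args Δ (vargs x)} → DHP (top (app (fv x) ts)) → AppArgs θ ts ts
  DHP-flex-args {ts = ts} dhp = appArgs-id ts λ x x∈ts →
    let _ , k , x∈tₖ = fvArgs-argAt x∈ts
    in ⊥-elim (proj₂ (DHPArgs.cond-i (dhp ts ⊵-refl) k) x x∈tₖ)

  args-ext : {ts ts' : Args Γ σs} → (∀ {τ} (k : τ ∈ σs) → argAt ts k ≡ argAt ts' k) → ts ≡ ts'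
  args-ext {ts = []} {[]} e = refl
  args-ext {ts = t ∷ ts} {t' ∷ ts'} e = cong₂ _∷_ (e (here refl)) (args-ext (λ k → e (there k)))

  zipArgs-argAt : ∀ {κs} (us : Args σs κs) (vs : Args ρs κs) (k : τ ∈ κs) →
                  (τ , argAt us k , argAt vs k) ∈ zipArgs us vs
  zipArgs-argAt (u ∷ us) (v ∷ vs) (here refl) = here refl
  zipArgs-argAt (u ∷ us) (v ∷ vs) (there k) = there (zipArgs-argAt us vs k)

  instT-argsEnv-etaT : (ts : Args Γ σs) {u : Tm σs τ} {i : τ ∈ σs} → u ≡ etaT τ i →
                       InstT (argsEnv ts) u (argAt ts i)
  instT-argsEnv-etaT ts refl = instT-etaT (argsEnv ts) _ ≤-refl refl

  -- Every argument pair of H lies in P₁ or P₂, and for either kind both sides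
  -- instantiate to the same term.
  diffSpec-agree : ∀ {κs} {ss : Args Δ σs} {ts : Args Δ ρs} {us : Args σs κs} {vs : Args ρs κs}
                   {us' vs'} → DiffSpec ss ts us vs →
                   InstArgs (argsEnv ss) us us' → InstArgs (argsEnv ts) vs vs' → us' ≡ vs'
  diffSpec-agree {κs = κs} {ss} {ts} {us} {vs} {us'} {vs'} (_ , spec) dus dvs = args-ext agree
    where
      agree : ∀ {κ} (k : κ ∈ κs) → argAt us' k ≡ argAt vs' k
      agree {κ} k with Equivalence.to (spec (κ , argAt us k , argAt vs k)) (zipArgs-argAt us vs k)
      ... | inj₁ (i , uₖ≡ , _ , vₖ↦) =
        trans (instT-det (instArgs-argAt dus k) (instT-argsEnv-etaT ss uₖ≡))
              (sym (instT-det (instArgs-argAt dvs k) vₖ↦))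
      ... | inj₂ (i , vₖ≡ , _ , uₖ↦) =
        trans (instT-det (instArgs-argAt dus k) uₖ↦)
              (sym (instT-det (instArgs-argAt dvs k) (instT-argsEnv-etaT ts vₖ≡)))

  different-unifies : ∀ {kF kG kH κs} {ss : Args Δ σs} {ts : Args Δ ρs}
                      {us : Args σs κs} {vs : Args ρs κs} →
                      let F = mkVar kF σs a ; G = mkVar kG ρs a ; H = mkVar kH κs a in
                      DHP (top (app (fv F) ss)) → DHP (top (app (fv G) ts)) →
                      DiffSpec ss ts us vs →
                      Maps2 δ F (top (app (fv H) us)) G (top (app (fv H) vs)) →
                      Unifies δ (top (app (fv F) ss) ≈ top (app (fv G) ts))
  different-unifies {ss = ss} {ts} {us} {vs} dhp-s dhp-t spec (δF≡ , δG≡ , _) =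
    let us' , dus = instArgs-total (argsEnv ss) (argsEnv-bounded ss) us
        vs' , dvs = instArgs-total (argsEnv ts) (argsEnv-bounded ts) vs
    in _ , a-lam (a-fv₁ δF≡ (DHP-flex-args dhp-s) (i-fv dus))
         , subst (λ ws → AppT _ _ (top (app (fv _) ws)))
                 (sym (diffSpec-agree {ss = ss} {ts} spec dus dvs))
                 (a-lam (a-fv₁ δG≡ (DHP-flex-args dhp-t) (i-fv dvs)))

  step-sound : (E₁ E₂ : List Pair) (θ θ' δ : Subst) → DHPProblem E₁ → Step E₁ θ E₂ θ' δ →
               (γ : Subst) → γ ∈𝒰 E₂ → (η : Subst) → IsComp δ γ η → η ∈𝒰 E₁
  step-sound E₁ E₂ θ θ' δ dhp (remove {s = s} pk empty _) γ γ∈𝒰 η c =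
    ∈𝒰-Picks pk (unifies-refl s) (∈𝒰-AppE c (appE-empty empty E₂) γ∈𝒰)
  step-sound E₁ E₂ θ θ' δ dhp (decompose {ss = ss} {ts} rigid pk empty _) γ γ∈𝒰 η c =
    let η∈𝒰E₂ = ∈𝒰-AppE c (appE-empty empty E₂) γ∈𝒰
    in ∈𝒰-Picks pk (decompose-unifies rigid (λ m → η∈𝒰E₂ (∈-++⁺ˡ m)))
                   (λ m → η∈𝒰E₂ (∈-++⁺ʳ (zipBind ss ts) m))
  step-sound E₁ E₂ θ θ' δ dhp (eliminate pk F∉u maps Eδ _) γ γ∈𝒰 η c =
    ∈𝒰-Picks pk (unifies-∘ c (eliminate-unifies maps F∉u)) (∈𝒰-AppE c Eδ γ∈𝒰)
  step-sound E₁ E₂ θ θ' δ dhp (imitate _ _ _ _ _ E₁δ _) γ γ∈𝒰 η c = ∈𝒰-AppE c E₁δ γ∈𝒰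
  step-sound E₁ E₂ θ θ' δ dhp (project _ _ _ _ _ _ _ _ _ E₁δ _) γ γ∈𝒰 η c = ∈𝒰-AppE c E₁δ γ∈𝒰
  step-sound E₁ E₂ θ θ' δ dhp (same sel pk se _ maps Eδ _) γ γ∈𝒰 η c =
    ∈𝒰-Picks pk (unifies-∘ c (same-unifies sel se maps)) (∈𝒰-AppE c Eδ γ∈𝒰)
  step-sound E₁ E₂ θ θ' δ dhp (different _ _ _ pk _ spec maps Eδ _) γ γ∈𝒰 η c =
    let dhp-s , dhp-t = picked-DHP dhp pk
    in ∈𝒰-Picks pk (unifies-∘ c (different-unifies dhp-s dhp-t spec maps)) (∈𝒰-AppE c Eδ γ∈𝒰)

lemma2 : (Sort Fun : Set) (funArgs : Fun → List (Ty Sort)) (funRes : Fun → Sort) →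
    let open Theory Sort Fun funArgs funRes in
    (E₁ E₂ : List Pair) (θ θ' δ : Subst) →
    DHPProblem E₁ →
    Step E₁ θ E₂ θ' δ →
    (γ : Subst) → γ ∈𝒰 E₂ →
    (η : Subst) → IsComp δ γ η →
    η ∈𝒰 E₁
lemma2 = Soundness.step-sound
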